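{- Let $n,m\ge1$, $d=n+\binom n2$, and $a^*\in\{0,1,\dots,m\}^n$. Then there exists a point $a\in mP(K_n)\cap\mathbb{Z}^d$ with $\pi(a)=a^*$ such that: for all faces $F^1,\dots,F^m$ of $P(K_n)$ with $a\in\sum_{b=1}^m F^b$, there exist vertices $\chi^b$ of $F^b$ with $a=\sum_{b=1}^m\chi^b$.
   Context: Vectors in $\mathbb{R}^d$ are indexed by $[n]\sqcup\binom{[n]}{2}$. For $S\subseteq[n]$, $a_S\in\{0,1\}^d$ has $a_{S,i}=1$ iff $i\in S$ and $a_{S,ij}=1$ iff $i,j\in S$. $P(K_n)=\mathrm{conv}\{a_S:S\subseteq[n]\}$ (correlation polytope), $mP(K_n)$ its $m$-th dilate. $\pi:\mathbb{R}^d\to\mathbb{R}^n$ is projection onto the vertex coordinates.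
   Formalization: The faces $F^1,\dots,F^m$ range only over those exposed by linear functionals with rational coefficients, and the points witnessing $a\in\sum_{b=1}^m F^b$ have rational coordinates. -}

module Defs where

open import Data.Nat as ℕ using (ℕ; zero; suc)
open import Data.Integer as ℤ using (ℤ)
open import Data.Rational as ℚ using (ℚ; 0ℚ; 1ℚ; _+_; _*_; _≤_; _/_)
open import Data.Fin using (Fin; zero; suc; _<_)
open import Data.Fin.Properties using (_<?_)
open import Data.Fin.Subset using (Subset)
open import Data.Vec using (lookup)
open import Data.Bool using (Bool; true; false; _∧_)
open import Data.List using (List; []; _∷_)
open import Data.List.Relation.Unary.All using (All)
open import Data.Product using (_×_; _,_; proj₁; proj₂; ∃)
open import Relation.Nullary using (yes; no)
open import Relation.Binary.PropositionalEquality using (_≡_)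

sumFin : {k : ℕ} → (Fin k → ℚ) → ℚ
sumFin {zero}  f = 0ℚ
sumFin {suc k} f = f zero + sumFin (λ i → f (suc i))

-- Vectors in ℚ^d, d = n + (n choose 2), indexed by [n] ⊔ binom([n],2).
-- The first component gives the vertex coordinates x_i; the second gives the
-- edge coordinates x_{ij}, of which only the entries with i < j are meaningful
-- (the edge {i,j} with i < j is represented by (i , j)).
Vect : ℕ → Set
Vect n = (Fin n → ℚ) × (Fin n → Fin n → ℚ)

ZVect : ℕ → Set
ZVect n = (Fin n → ℤ) × (Fin n → Fin n → ℤ)

toℚV : {n : ℕ} → ZVect n → Vect n
toℚV (u , w) = (λ i → u i / 1) , (λ i j → w i j / 1)

_≈V_ : {n : ℕ} → Vect n → Vect n → Set
_≈V_ {n} x y = (∀ (i : Fin n) → proj₁ x i ≡ proj₁ y i)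
             × (∀ (i j : Fin n) → i < j → proj₂ x i j ≡ proj₂ y i j)

zeroV : {n : ℕ} → Vect n
zeroV = (λ _ → 0ℚ) , (λ _ _ → 0ℚ)

_+V_ : {n : ℕ} → Vect n → Vect n → Vect n
(u , w) +V (u' , w') = (λ i → u i + u' i) , (λ i j → w i j + w' i j)

_·V_ : {n : ℕ} → ℚ → Vect n → Vect n
t ·V (u , w) = (λ i → t * u i) , (λ i j → t * w i j)

sumV : {n k : ℕ} → (Fin k → Vect n) → Vect n
sumV {n} {zero}  f = zeroV
sumV {n} {suc k} f = f zero +V sumV (λ b → f (suc b))

dot : {n : ℕ} → Vect n → Vect n → ℚ
dot (u , w) (u' , w') =
  sumFin (λ i → u i * u' i)
  + sumFin (λ i → sumFin (λ j → edgeTerm i j))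
  where
  edgeTerm : _ → _ → ℚ
  edgeTerm i j with i <? j
  ... | yes _ = w i j * w' i j
  ... | no  _ = 0ℚ

ind : Bool → ℚ
ind true  = 1ℚ
ind false = 0ℚ

aS : {n : ℕ} → Subset n → Vect n
aS S = (λ i → ind (lookup S i)) , (λ i j → ind (lookup S i ∧ lookup S j))

combo : {n : ℕ} → List (ℚ × Subset n) → Vect n
combo []             = zeroV
combo ((w , S) ∷ L)  = (w ·V aS S) +V combo L

weightSum : {n : ℕ} → List (ℚ × Subset n) → ℚ
weightSum []            = 0ℚ
weightSum ((w , _) ∷ L) = w + weightSum L

-- x ∈ t·P(K_n) = t · conv{a_S : S ⊆ [n]} (t ≥ 0): x is a nonnegative
-- combination of the a_S with total weight t.
InDilate : {n : ℕ} → ℚ → Vect n → Set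
InDilate {n} t x =
  ∃ λ (L : List (ℚ × Subset n)) →
    All (λ p → 0ℚ ≤ proj₁ p) L × weightSum L ≡ t × x ≈V combo L

InP : {n : ℕ} → Vect n → Set
InP = InDilate 1ℚ

-- The face of P(K_n) exposed by the linear functional c:
-- F_c = { x ∈ P(K_n) : c·x ≥ c·y for all y ∈ P(K_n) }
-- (it suffices to compare with the vertices a_T).
InFace : {n : ℕ} → Vect n → Vect n → Set
InFace {n} c x = InP x × (∀ (T : Subset n) → dot c (aS T) ≤ dot c x)

-- a_S is a vertex of the face F_c (the vertices of P(K_n) are exactly the
-- a_S, and the vertices of a face are the vertices of P(K_n) lying in it).
IsVertexOfFace : {n : ℕ} → Vect n → Subset n → Set
IsVertexOfFace c S = InFace c (aS S)

{-# OPTIONS --safe #-}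
module Submission where

-- The point is a = (a*ᵢ ; min(a*ᵢ, a*ⱼ)), the sum of the vertices of the level sets
-- U θ = {i : θ ≤ a*ᵢ} for θ = 1, …, m.
-- Suppose a = Σ_b y_b with y_b in the face F^b, and write each y_b as a convex combination of
-- vertices a_S. Every vertex satisfies a_S,ij ≤ a_S,i and 0 ≤ a_S,i ≤ 1, and summed over all b
-- these inequalities are equalities at a (a_ij = a_i when a*ᵢ ≤ a*ⱼ, a_i = 0 when a*ᵢ = 0,
-- a_i = m when a*ᵢ = m). So they are equalities on every vertex that is used, which makes it a
-- level set U θ with 1 ≤ θ ≤ m. Grouping the coefficients of y_b by θ gives a fractional
-- assignment of the m faces to the thresholds whose column sums are integers: the gaps between
-- consecutive breakpoints among 0, m, a*₁, …, a*ₙ. Hall's theorem with capacities rounds it to an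
-- integral assignment with the same column sums, and the level set assigned to face b is a vertex
-- of F^b, since a point of a face is a convex combination of vertices of that face only.

open import Defs
open import Algebra.Bundles using (CommutativeRing)
import Algebra.Properties.Group as GroupProperties
import Algebra.Properties.Semiring.Sum as SemiringSum
open import Data.Bool using (Bool; true; false; T; not; _∧_; _∨_; if_then_else_)
open import Data.Bool.Properties using (T-∧; T-∨; ∧-comm; ∧-idem; ∧-identityʳ; ∧-zeroʳ)
open import Data.Empty using (⊥-elim)
open import Data.Fin as Fin using (Fin; zero; suc; toℕ; _≟_)
open import Data.Fin.Properties as FinP using (any?)
open import Data.Fin.Subset using (Subset)
open import Data.Fin.Subset.Properties using (anySubset?)
import Data.Integer as ℤ
import Data.Integer.Properties as ℤP
open import Data.List as List using (List; []; _∷_; length)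
open import Data.List.Membership.Propositional.Properties using (∈-lookup)
open import Data.List.Relation.Unary.All as All using (All; []; _∷_)
open import Data.Nat as ℕ using (ℕ; zero; suc; z≤n; s≤s; _⊓_; _∸_; _≤ᵇ_; _≡ᵇ_)
open import Data.Nat.Coprimality as Coprime using (1-coprimeTo)
import Data.Nat.Properties as ℕP
open import Data.Product using (_×_; _,_; proj₁; proj₂; ∃; Σ; uncurry)
open import Data.Rational as ℚ using (ℚ; 0ℚ; 1ℚ; mkℚ)
import Data.Rational.Properties as ℚP
open import Data.Rational.Solver using (module +-*-Solver)
import Data.Rational.Unnormalised as ℚᵘ
import Data.Rational.Unnormalised.Properties as ℚᵘP
open import Data.Sum using (_⊎_; inj₁; inj₂)
open import Data.Unit using (tt)
open import Data.Vec using (lookup; tabulate; []; _∷_)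
open import Data.Vec.Properties using (lookup∘tabulate)
open import Function using (_∘_)
open import Function.Bundles using (Equivalence)
open import Relation.Binary using (tri<; tri≈; tri>)
open import Relation.Binary.PropositionalEquality
open import Relation.Nullary using (Dec; yes; no; ¬_; does; _×-dec_)
open import Relation.Nullary.Decidable using (T?; _⊎-dec_)

module ℕΣ = SemiringSum ℕP.+-*-semiring
module ℚΣ = SemiringSum (CommutativeRing.semiring ℚP.+-*-commutativeRing)

T-injective : ∀ {x y} → (T x → T y) → (T y → T x) → x ≡ y
T-injective {true}  {true}  _   _   = refl
T-injective {true}  {false} x⇒y _   = ⊥-elim (x⇒y tt)
T-injective {false} {true}  _   y⇒x = ⊥-elim (y⇒x tt)
T-injective {false} {false} _   _   = refl

∧-intro : ∀ {x y} → T x → T y → T (x ∧ y)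
∧-intro p q = Equivalence.from T-∧ (p , q)

∧-elim : ∀ x {y} → T (x ∧ y) → T x × T y
∧-elim true y = tt , y

T-not⇒¬T : ∀ x → T (not x) → ¬ T x
T-not⇒¬T true ()

¬T⇒T-not : ∀ x → ¬ T x → T (not x)
¬T⇒T-not true  ¬x = ¬x tt
¬T⇒T-not false _  = tt

¬T-∧-not⇒implies : ∀ x y → ¬ T (x ∧ not y) → T x → T y
¬T-∧-not⇒implies true true  _      _ = tt
¬T-∧-not⇒implies true false ¬x∧¬y _ = ¬x∧¬y tt

does-sound : ∀ {P : Set} (d : Dec P) → T (does d) → P
does-sound (yes p) _ = p

does-complete : ∀ {P : Set} (d : Dec P) → P → T (does d)
does-complete (yes _) _ = tt
does-complete (no ¬p) p = ¬p p

≤ᵇ-⊓ : ∀ θ a b → (θ ≤ᵇ a) ∧ (θ ≤ᵇ b) ≡ (θ ≤ᵇ a ⊓ b)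
≤ᵇ-⊓ θ a b = T-injective
  (λ p → let θ≤a , θ≤b = ∧-elim (θ ≤ᵇ a) p in ℕP.≤⇒≤ᵇ (ℕP.⊓-glb (ℕP.≤ᵇ⇒≤ θ a θ≤a) (ℕP.≤ᵇ⇒≤ θ b θ≤b)))
  (λ p → let θ≤a⊓b = ℕP.≤ᵇ⇒≤ θ (a ⊓ b) p in
         ∧-intro (ℕP.≤⇒≤ᵇ (ℕP.≤-trans θ≤a⊓b (ℕP.m⊓n≤m a b))) (ℕP.≤⇒≤ᵇ (ℕP.≤-trans θ≤a⊓b (ℕP.m⊓n≤n a b))))

least : ∀ {n} → (Fin n → ℕ) → ℕ → Subset n → ℕ
least a top []          = top
least a top (true  ∷ S) = a zero ⊓ least (a ∘ suc) top S
least a top (false ∷ S) = least (a ∘ suc) top S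

least-≤-top : ∀ {n} (a : Fin n → ℕ) top S → least a top S ℕ.≤ top
least-≤-top a top []          = ℕP.≤-refl
least-≤-top a top (true  ∷ S) = ℕP.≤-trans (ℕP.m⊓n≤n _ _) (least-≤-top (a ∘ suc) top S)
least-≤-top a top (false ∷ S) = least-≤-top (a ∘ suc) top S

least-≤-member : ∀ {n} (a : Fin n → ℕ) top S {i} → T (lookup S i) → least a top S ℕ.≤ a i
least-≤-member a top (true  ∷ S) {zero}  _   = ℕP.m⊓n≤m _ _
least-≤-member a top (true  ∷ S) {suc i} i∈S = ℕP.≤-trans (ℕP.m⊓n≤n _ _) (least-≤-member (a ∘ suc) top S i∈S)
least-≤-member a top (false ∷ S) {suc i} i∈S = least-≤-member (a ∘ suc) top S i∈S

least-attained : ∀ {n} (a : Fin n → ℕ) top S →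
                 least a top S ≡ top ⊎ ∃ λ i → T (lookup S i) × least a top S ≡ a i
least-attained a top []          = inj₁ refl
least-attained a top (true  ∷ S) with ℕP.⊓-sel (a zero) (least (a ∘ suc) top S)
... | inj₁ first = inj₂ (zero , tt , first)
... | inj₂ rest with least-attained (a ∘ suc) top S
...   | inj₁ top≡             = inj₁ (trans rest top≡)
...   | inj₂ (i , i∈S , a≡)   = inj₂ (suc i , i∈S , trans rest a≡)
least-attained a top (false ∷ S) with least-attained (a ∘ suc) top S
... | inj₁ top≡             = inj₁ top≡
... | inj₂ (i , i∈S , a≡)   = inj₂ (suc i , i∈S , a≡)

module Sums where

  open import Data.Rational using (_+_; _*_; _≤_; _<_; _/_)
  open ℚΣ public

  ι : ℕ → ℚ
  ι k = ℤ.+ k / 1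

  ι-mkℚ : ∀ k → ι k ≡ mkℚ (ℤ.+ k) 0 (Coprime.sym (1-coprimeTo k))
  ι-mkℚ k = ℚP.normalize-coprime (Coprime.sym (1-coprimeTo k))

  ι-+ : ∀ a b → ι (a ℕ.+ b) ≡ ι a + ι b
  ι-+ a b = ℚP.toℚᵘ-injective (ℚᵘP.≃-trans lhs (ℚᵘP.≃-sym (ℚP.toℚᵘ-homo-+ (ι a) (ι b))))
    where
    lhs : ℚ.toℚᵘ (ι (a ℕ.+ b)) ℚᵘ.≃ (ℚ.toℚᵘ (ι a) ℚᵘ.+ ℚ.toℚᵘ (ι b))
    lhs rewrite ι-mkℚ (a ℕ.+ b) | ι-mkℚ a | ι-mkℚ b =
      ℚᵘ.*≡* (cong (ℤ._* ℤ.+ 1) (sym (cong₂ ℤ._+_ (ℤP.*-identityʳ (ℤ.+ a)) (ℤP.*-identityʳ (ℤ.+ b)))))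

  ι-mono-≤ : ∀ {a b} → a ℕ.≤ b → ι a ≤ ι b
  ι-mono-≤ {a} {b} a≤b rewrite ι-mkℚ a | ι-mkℚ b =
    ℚ.*≤* (subst₂ ℤ._≤_ (sym (ℤP.*-identityʳ (ℤ.+ a))) (sym (ℤP.*-identityʳ (ℤ.+ b))) (ℤ.+≤+ a≤b))

  ι-cancel-≤ : ∀ {a b} → ι a ≤ ι b → a ℕ.≤ b
  ι-cancel-≤ {a} {b} ιa≤ιb rewrite ι-mkℚ a | ι-mkℚ b with ιa≤ιb
  ... | ℚ.*≤* p with subst₂ ℤ._≤_ (ℤP.*-identityʳ (ℤ.+ a)) (ℤP.*-identityʳ (ℤ.+ b)) p
  ...   | ℤ.+≤+ a≤b = a≤b

  ι-injective : ∀ {a b} → ι a ≡ ι b → a ≡ b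
  ι-injective e = ℕP.≤-antisym (ι-cancel-≤ (ℚP.≤-reflexive e)) (ι-cancel-≤ (ℚP.≤-reflexive (sym e)))

  ι-∸ : ∀ {a b} → b ℕ.≤ a → ι (a ℕ.∸ b) + ι b ≡ ι a
  ι-∸ {a} {b} b≤a = trans (sym (ι-+ (a ℕ.∸ b) b)) (cong ι (ℕP.m∸n+n≡m b≤a))

  ι-∑ : ∀ {k} (f : Fin k → ℕ) → ι (ℕΣ.sum f) ≡ ∑[ i < k ] ι (f i)
  ι-∑ {zero}  f = refl
  ι-∑ {suc k} f = trans (ι-+ (f zero) _) (cong (ι (f zero) +_) (ι-∑ (f ∘ suc)))

  sumFin≡∑ : ∀ {k} (f : Fin k → ℚ) → sumFin f ≡ ∑[ i < k ] f i
  sumFin≡∑ {zero}  f = refl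
  sumFin≡∑ {suc k} f = cong (f zero +_) (sumFin≡∑ (f ∘ suc))

  ∑-zero : ∀ {k} {f : Fin k → ℚ} → (∀ i → f i ≡ 0ℚ) → ∑[ i < k ] f i ≡ 0ℚ
  ∑-zero {k} f≡0 = trans (sum-cong-≗ f≡0) (sum-replicate-zero k)

  ∑-mono-≤ : ∀ {k} {f g : Fin k → ℚ} → (∀ i → f i ≤ g i) → ∑[ i < k ] f i ≤ ∑[ i < k ] g i
  ∑-mono-≤ {zero}  f≤g = ℚP.≤-refl
  ∑-mono-≤ {suc k} f≤g = ℚP.+-mono-≤ (f≤g zero) (∑-mono-≤ (f≤g ∘ suc))

  +-≤-≡⇒≡ : ∀ {a b c d : ℚ} → a ≤ b → c ≤ d → a + c ≡ b + d → a ≡ b × c ≡ d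
  +-≤-≡⇒≡ {a} {b} {c} {d} a≤b c≤d a+c≡b+d = left , right
    where
    left : a ≡ b
    left with ℚP.<-cmp a b
    ... | tri< a<b _ _ = ⊥-elim (ℚP.<-irrefl a+c≡b+d (ℚP.+-mono-<-≤ a<b c≤d))
    ... | tri≈ _ a≡b _ = a≡b
    ... | tri> _ _ b<a = ⊥-elim (ℚP.<-irrefl refl (ℚP.<-≤-trans b<a a≤b))
    right : c ≡ d
    right with ℚP.<-cmp c d
    ... | tri< c<d _ _ = ⊥-elim (ℚP.<-irrefl a+c≡b+d (ℚP.+-mono-≤-< a≤b c<d))
    ... | tri≈ _ c≡d _ = c≡d
    ... | tri> _ _ d<c = ⊥-elim (ℚP.<-irrefl refl (ℚP.<-≤-trans d<c c≤d))

  ∑-≤-≡⇒≡ : ∀ {k} {f g : Fin k → ℚ} → (∀ i → f i ≤ g i) →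
            ∑[ i < k ] f i ≡ ∑[ i < k ] g i → ∀ i → f i ≡ g i
  ∑-≤-≡⇒≡ {suc k} f≤g ∑≡ zero    = proj₁ (+-≤-≡⇒≡ (f≤g zero) (∑-mono-≤ (f≤g ∘ suc)) ∑≡)
  ∑-≤-≡⇒≡ {suc k} f≤g ∑≡ (suc i) =
    ∑-≤-≡⇒≡ (f≤g ∘ suc) (proj₂ (+-≤-≡⇒≡ (f≤g zero) (∑-mono-≤ (f≤g ∘ suc)) ∑≡)) i

  ∑-positive⇒∃ : ∀ {k} (f : Fin k → ℚ) → 0ℚ < ∑[ i < k ] f i → ∃ λ i → 0ℚ < f i
  ∑-positive⇒∃ {k} f 0<∑ with FinP.any? (λ i → 0ℚ ℚP.<? f i)
  ... | yes witness = witness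
  ... | no none = ⊥-elim (ℚP.<-irrefl refl (ℚP.<-≤-trans 0<∑ ∑≤0))
    where
    ∑≤0 : ∑[ i < k ] f i ≤ 0ℚ
    ∑≤0 = ℚP.≤-trans (∑-mono-≤ (λ i → ℚP.≮⇒≥ (λ 0<fi → none (i , 0<fi)))) (ℚP.≤-reflexive (sum-replicate-zero k))

  ∑-1 : ∀ k → ∑[ i < k ] 1ℚ ≡ ι k
  ∑-1 zero    = refl
  ∑-1 (suc k) = trans (cong (1ℚ +_) (∑-1 k)) (sym (ι-+ 1 k))

  ∑-δ : ∀ {k} (x : Fin k) (g : Fin k → ℚ) → ∑[ t < k ] (ind (does (x ≟ t)) * g t) ≡ g x
  ∑-δ {suc k} zero g = begin
    1ℚ * g zero + ∑[ t < k ] (0ℚ * g (suc t)) ≡⟨ cong₂ _+_ (ℚP.*-identityˡ (g zero)) (sum-cong-≗ (λ t → ℚP.*-zeroˡ (g (suc t)))) ⟩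
    g zero + ∑[ t < k ] 0ℚ                    ≡⟨ cong (g zero +_) (sum-replicate-zero k) ⟩
    g zero + 0ℚ                               ≡⟨ ℚP.+-identityʳ (g zero) ⟩
    g zero                                    ∎
    where open ≡-Reasoning
  ∑-δ {suc k} (suc x) g = begin
    0ℚ * g zero + ∑[ t < k ] (ind (does (suc x ≟ suc t)) * g (suc t)) ≡⟨ cong₂ _+_ (ℚP.*-zeroˡ (g zero)) refl ⟩
    0ℚ + ∑[ t < k ] (ind (does (x ≟ t)) * g (suc t))                  ≡⟨ ℚP.+-identityˡ _ ⟩
    ∑[ t < k ] (ind (does (x ≟ t)) * g (suc t))                       ≡⟨ ∑-δ x (g ∘ suc) ⟩
    g (suc x)                                                          ∎
    where open ≡-Reasoning

  telescope : (g h : ℕ → ℚ) → (∀ s → g (suc s) ≡ h s + g s) →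
              ∀ {k} v → v ℕ.≤ k → ∑[ t < k ] (ind (suc (toℕ t) ≤ᵇ v) * h (toℕ t)) + g 0 ≡ g v
  telescope g h step {zero}  zero    z≤n = ℚP.+-identityˡ (g 0)
  telescope g h step {suc k} zero    z≤n = begin
    ∑[ t < suc k ] (0ℚ * h (toℕ t)) + g 0 ≡⟨ cong (_+ g 0) (∑-zero {suc k} (λ t → ℚP.*-zeroˡ (h (toℕ t)))) ⟩
    0ℚ + g 0                               ≡⟨ ℚP.+-identityˡ (g 0) ⟩
    g 0                                    ∎
    where open ≡-Reasoning
  telescope g h step {suc k} (suc v) (s≤s v≤k) = begin
    (1ℚ * h 0 + rest) + g 0 ≡⟨ cong (λ x → (x + rest) + g 0) (ℚP.*-identityˡ (h 0)) ⟩
    (h 0 + rest) + g 0      ≡⟨ cong (_+ g 0) (ℚP.+-comm (h 0) rest) ⟩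
    (rest + h 0) + g 0      ≡⟨ ℚP.+-assoc rest (h 0) (g 0) ⟩
    rest + (h 0 + g 0)      ≡⟨ cong (rest +_) (sym (step 0)) ⟩
    rest + g 1              ≡⟨ telescope (g ∘ suc) (h ∘ suc) (step ∘ suc) v v≤k ⟩
    g (suc v)               ∎
    where
    open ≡-Reasoning
    rest = ∑[ t < k ] (ind (suc (toℕ t) ≤ᵇ v) * h (suc (toℕ t)))

  ∑-weighted-tight : ∀ {k} (w f g : Fin k → ℚ) → (∀ i → 0ℚ ≤ w i) → (∀ i → f i ≤ g i) →
                     ∑[ i < k ] (w i * f i) ≡ ∑[ i < k ] (w i * g i) → ∀ i → 0ℚ < w i → f i ≡ g i
  ∑-weighted-tight w f g w≥0 f≤g ∑≡ i 0<wi =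
    ℚP.≤-antisym (ℚP.*-cancelˡ-≤-pos (w i) (ℚP.≤-reflexive wf≡wg)) (ℚP.*-cancelˡ-≤-pos (w i) (ℚP.≤-reflexive (sym wf≡wg)))
    where
    instance
      _ = ℚ.positive 0<wi
    wf≡wg : w i * f i ≡ w i * g i
    wf≡wg = ∑-≤-≡⇒≡ (λ j → ℚP.*-monoˡ-≤-nonNeg (w j) {{ℚ.nonNegative (w≥0 j)}} (f≤g j)) ∑≡ i

  ∑-≤ᵇ : ∀ {k} v → v ℕ.≤ k → ∑[ t < k ] ind (suc (toℕ t) ≤ᵇ v) ≡ ι v
  ∑-≤ᵇ {k} v v≤k = begin
    ∑[ t < k ] ind (suc (toℕ t) ≤ᵇ v)               ≡⟨ sum-cong-≗ {k} (λ t → ℚP.*-identityʳ (ind (suc (toℕ t) ≤ᵇ v))) ⟨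
    ∑[ t < k ] (ind (suc (toℕ t) ≤ᵇ v) * 1ℚ)        ≡⟨ ℚP.+-identityʳ (∑[ t < k ] (ind (suc (toℕ t) ≤ᵇ v) * 1ℚ)) ⟨
    ∑[ t < k ] (ind (suc (toℕ t) ≤ᵇ v) * 1ℚ) + ι 0  ≡⟨ telescope ι (λ _ → 1ℚ) (ι-+ 1) v v≤k ⟩
    ι v                                              ∎
    where open ≡-Reasoning

  ind-T : ∀ x → T x → ind x ≡ 1ℚ
  ind-T true _ = refl

  ind-¬T : ∀ x → ¬ T x → ind x ≡ 0ℚ
  ind-¬T true  ¬x = ⊥-elim (¬x tt)
  ind-¬T false _  = refl

  ind-split : ∀ x y → ind x ≡ ind (x ∧ y) + ind (x ∧ not y)
  ind-split true  true  = sym (ℚP.+-identityʳ 1ℚ)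
  ind-split true  false = sym (ℚP.+-identityˡ 1ℚ)
  ind-split false y     = sym (ℚP.+-identityˡ 0ℚ)

  ind-step : ∀ θ s → ind (θ ≤ᵇ suc s) ≡ ind (θ ≡ᵇ suc s) + ind (θ ≤ᵇ s)
  ind-step zero          s       = sym (ℚP.+-identityˡ 1ℚ)
  ind-step (suc zero)    zero    = sym (ℚP.+-identityʳ 1ℚ)
  ind-step (suc (suc θ)) zero    = sym (ℚP.+-identityˡ 0ℚ)
  ind-step (suc zero)    (suc s) = sym (ℚP.+-identityˡ 1ℚ)
  ind-step (suc (suc θ)) (suc s) = ind-step (suc θ) s

  ind-nonneg : ∀ x → 0ℚ ≤ ind x
  ind-nonneg true  = ℚP.nonNegative⁻¹ 1ℚ
  ind-nonneg false = ℚP.≤-refl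

  ind-vanishes : ∀ x → ind x ≡ 0ℚ → ¬ T x
  ind-vanishes true ()

  *-ind-positive : ∀ w x → 0ℚ < w * ind x → 0ℚ < w × T x
  *-ind-positive w true  0<w*1 = subst (0ℚ <_) (ℚP.*-identityʳ w) 0<w*1 , tt
  *-ind-positive w false 0<w*0 = ⊥-elim (ℚP.<-irrefl (sym (ℚP.*-zeroʳ w)) 0<w*0)

module Subsets where

  open import Data.Nat using (_+_; _≤_; _<_; _<?_)
  open ℕΣ

  infixr 7 _∩_
  infixr 6 _∪_ _─_
  infix  4 _⊆_

  _∩_ _∪_ _─_ : ∀ {n} → (Fin n → Bool) → (Fin n → Bool) → Fin n → Bool
  (A ∩ B) i = A i ∧ B i
  (A ∪ B) i = A i ∨ B i
  (A ─ B) i = A i ∧ not (B i)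

  _⊆_ : ∀ {n} → (Fin n → Bool) → (Fin n → Bool) → Set
  A ⊆ B = ∀ i → T (A i) → T (B i)

  ⁅_⁆ : ∀ {n} → Fin n → Fin n → Bool
  ⁅ i ⁆ j = does (i ≟ j)

  ⁅⁆-sound : ∀ {n} {i j : Fin n} → T (⁅ i ⁆ j) → i ≡ j
  ⁅⁆-sound {i = i} {j} j∈⁅i⁆ with i ≟ j
  ... | yes i≡j = i≡j

  weight : ∀ {n} → (Fin n → ℕ) → (Fin n → Bool) → ℕ
  weight {n} c A = ∑[ i < n ] (if A i then c i else 0)

  ∣_∣ : ∀ {n} → (Fin n → Bool) → ℕ
  ∣ A ∣ = weight (λ _ → 1) A

  ∑ℕ-mono-≤ : ∀ {k} {f g : Fin k → ℕ} → (∀ i → f i ≤ g i) → ∑[ i < k ] f i ≤ ∑[ i < k ] g i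
  ∑ℕ-mono-≤ {zero}  f≤g = z≤n
  ∑ℕ-mono-≤ {suc k} f≤g = ℕP.+-mono-≤ (f≤g zero) (∑ℕ-mono-≤ (f≤g ∘ suc))

  module _ {n : ℕ} where

    weight-cong : ∀ c {A B : Fin n → Bool} → (∀ i → A i ≡ B i) → weight c A ≡ weight c B
    weight-cong c A≗B = sum-cong-≗ (λ i → cong (λ x → if x then c i else 0) (A≗B i))

    weight-split : ∀ c (A B : Fin n → Bool) → weight c A ≡ weight c (A ∩ B) + weight c (A ─ B)
    weight-split c A B = trans (sum-cong-≗ (λ i → split (A i) (B i) (c i))) (∑-distrib-+ {n} _ _)
      where
      split : ∀ a b x → (if a then x else 0) ≡ (if a ∧ b then x else 0) + (if a ∧ not b then x else 0)
      split true  true  x = sym (ℕP.+-identityʳ x)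
      split true  false x = refl
      split false b     x = refl

    weight-mono-⊆ : ∀ c {A B : Fin n → Bool} → A ⊆ B → weight c A ≤ weight c B
    weight-mono-⊆ c {A} {B} A⊆B = ∑ℕ-mono-≤ (λ i → pointwise (A i) (B i) (c i) (A⊆B i))
      where
      pointwise : ∀ a b x → (T a → T b) → (if a then x else 0) ≤ (if b then x else 0)
      pointwise true  true  x _ = ℕP.≤-refl
      pointwise true  false x a⇒b = ⊥-elim (a⇒b tt)
      pointwise false b     x _ = z≤n

    weight-empty : ∀ c {A : Fin n → Bool} → (∀ i → ¬ T (A i)) → weight c A ≡ 0
    weight-empty c {A} A-empty = trans (sum-cong-≗ (λ i → pointwise (A i) (c i) (A-empty i))) (sum-replicate-zero n)
      where
      pointwise : ∀ a x → ¬ T a → (if a then x else 0) ≡ 0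
      pointwise true  x a∉ = ⊥-elim (a∉ tt)
      pointwise false x _  = refl

    weight-positive : ∀ c (A : Fin n → Bool) → 0 < weight c A → ∃ λ i → T (A i) × 0 < c i
    weight-positive c A 0<w with any? (λ i → T? (A i) ×-dec (0 <? c i))
    ... | yes witness = witness
    ... | no none = ⊥-elim (ℕP.<-irrefl (sym w≡0) 0<w)
      where
      w≡0 : weight c A ≡ 0
      w≡0 = trans (sum-cong-≗ (λ i → pointwise (A i) (c i) (λ a 0<x → none (i , a , 0<x)))) (sum-replicate-zero n)
        where
        pointwise : ∀ a x → (T a → ¬ 0 < x) → (if a then x else 0) ≡ 0
        pointwise true  zero    _   = refl
        pointwise true  (suc x) a⇏ = ⊥-elim (a⇏ tt (s≤s z≤n))
        pointwise false x       _   = refl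

  ∣⁅⁆∣ : ∀ {n} (i : Fin n) → ∣ ⁅ i ⁆ ∣ ≡ 1
  ∣⁅⁆∣ {suc n} zero    = cong suc (sum-replicate-zero n)
  ∣⁅⁆∣ {suc n} (suc i) = ∣⁅⁆∣ i

  ⁅⁆-⊆ : ∀ {n} {A : Fin n → Bool} {b} → T (A b) → ⁅ b ⁆ ⊆ A
  ⁅⁆-⊆ {A = A} b∈A j b≡j = subst (T ∘ A) (⁅⁆-sound b≡j) b∈A

  member⇒∣∣-positive : ∀ {n} (A : Fin n → Bool) {b} → T (A b) → 0 < ∣ A ∣
  member⇒∣∣-positive A {b} b∈A = subst (_≤ ∣ A ∣) (∣⁅⁆∣ b) (weight-mono-⊆ (λ _ → 1) (⁅⁆-⊆ {A = A} b∈A))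

  ∣∣-split-⊆ : ∀ {n} (A B : Fin n → Bool) → B ⊆ A → ∣ A ∣ ≡ ∣ B ∣ + ∣ A ─ B ∣
  ∣∣-split-⊆ A B B⊆A =
    trans (weight-split (λ _ → 1) A B) (cong (_+ ∣ A ─ B ∣) (weight-cong (λ _ → 1) (λ b → inside (A b) (B b) (B⊆A b))))
    where
    inside : ∀ a e → (T e → T a) → a ∧ e ≡ e
    inside true  e     _   = refl
    inside false true  e⇒a = ⊥-elim (e⇒a tt)
    inside false false _   = refl

  ∣∣-remove : ∀ {n} (A : Fin n → Bool) {b} → T (A b) → ∣ A ∣ ≡ suc ∣ A ─ ⁅ b ⁆ ∣
  ∣∣-remove A {b} b∈A = trans (∣∣-split-⊆ A ⁅ b ⁆ (⁅⁆-⊆ {A = A} b∈A)) (cong (_+ ∣ A ─ ⁅ b ⁆ ∣) (∣⁅⁆∣ b))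

  ∣∪∣-disjoint : ∀ {n} (D B : Fin n → Bool) → (∀ b → T (D b) → ¬ T (B b)) → ∣ D ∪ B ∣ ≡ ∣ B ∣ + ∣ D ∣
  ∣∪∣-disjoint D B disjoint = trans (weight-split (λ _ → 1) (D ∪ B) B)
    (cong₂ _+_ (weight-cong (λ _ → 1) (λ b → kept (D b) (B b))) (weight-cong (λ _ → 1) (λ b → rest (D b) (B b) (disjoint b))))
    where
    kept : ∀ d e → (d ∨ e) ∧ e ≡ e
    kept true  e = refl
    kept false e = ∧-idem e
    rest : ∀ d e → (T d → ¬ T e) → (d ∨ e) ∧ not e ≡ d
    rest true  true  d⇒¬e = ⊥-elim (d⇒¬e tt tt)
    rest true  false _    = refl
    rest false true  _    = refl
    rest false false _    = refl

  preimage : ∀ {m K} → (Fin m → Fin K) → Fin K → Fin m → Bool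
  preimage f k b = does (f b ≟ k)

  override : ∀ {m K} → (Fin m → Bool) → (Fin m → Fin K) → (Fin m → Fin K) → Fin m → Fin K
  override B f g b = if B b then f b else g b

-- `fallback` only fills in the match outside the set being matched.
module Hall {m K : ℕ} (Adj : Fin m → Fin K → Bool) (fallback : Fin m → Fin K) where

  open import Data.Nat using (_+_; _≤_; _<_; _<?_)
  open ℕΣ
  open Subsets

  neighbours : (Fin m → Bool) → Fin K → Bool
  neighbours B k = does (any? (λ b → T? (B b ∧ Adj b k)))

  neighbours-intro : ∀ {B b k} → T (B b) → T (Adj b k) → T (neighbours B k)
  neighbours-intro {B} {b} {k} b∈B adj with any? (λ b → T? (B b ∧ Adj b k))
  ... | yes _   = tt
  ... | no none = none (b , ∧-intro b∈B adj)

  neighbours-elim : ∀ {B k} → T (neighbours B k) → ∃ λ b → T (B b) × T (Adj b k)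
  neighbours-elim {B} {k} k∈N with any? (λ b → T? (B b ∧ Adj b k))
  ... | yes (b , p) = b , ∧-elim (B b) p

  neighbours-mono : ∀ {B B′} → B ⊆ B′ → neighbours B ⊆ neighbours B′
  neighbours-mono B⊆B′ k k∈N with neighbours-elim k∈N
  ... | b , b∈B , adj = neighbours-intro (B⊆B′ b b∈B) adj

  neighbours-cong : ∀ {B B′} → (∀ b → B b ≡ B′ b) → ∀ k → neighbours B k ≡ neighbours B′ k
  neighbours-cong B≗B′ k =
    T-injective (neighbours-mono (λ b → subst T (B≗B′ b)) k) (neighbours-mono (λ b → subst T (sym (B≗B′ b))) k)

  neighbours-∪ : ∀ (D B : Fin m → Bool) → neighbours (D ∪ B) ⊆ neighbours D ∪ neighbours B
  neighbours-∪ D B k k∈N with neighbours-elim k∈N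
  ... | b , b∈D∪B , adj with Equivalence.to T-∨ b∈D∪B
  ...   | inj₁ b∈D = Equivalence.from T-∨ (inj₁ (neighbours-intro b∈D adj))
  ...   | inj₂ b∈B = Equivalence.from T-∨ (inj₂ (neighbours-intro b∈B adj))

  HallCondition : (Fin m → Bool) → (Fin K → ℕ) → Set
  HallCondition A c = ∀ B → B ⊆ A → ∣ B ∣ ≤ weight c (neighbours B)

  record Matching (A : Fin m → Bool) (c : Fin K → ℕ) : Set where
    field
      match    : Fin m → Fin K
      adjacent : ∀ b → T (A b) → T (Adj b (match b))
      bounded  : ∀ k → ∣ A ∩ preimage match k ∣ ≤ c k

  restrict : ∀ {A B c} → B ⊆ A → HallCondition A c → HallCondition B c
  restrict B⊆A hall D D⊆B = hall D (λ b → B⊆A b ∘ D⊆B b)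

  reachable : ∀ {A c b} → HallCondition A c → T (A b) → ∃ λ k → T (Adj b k) × 0 < c k
  reachable {A} {c} {b} hall b∈A with weight-positive c (neighbours ⁅ b ⁆)
                                         (subst (_≤ weight c (neighbours ⁅ b ⁆)) (∣⁅⁆∣ b) (hall ⁅ b ⁆ (⁅⁆-⊆ {A = A} b∈A)))
  ... | k , k∈N , 0<c[k] with neighbours-elim k∈N
  ...   | b′ , b≡b′ , b′~k = k , subst (λ b → T (Adj b k)) (sym (⁅⁆-sound b≡b′)) b′~k , 0<c[k]

  override-adjacent : ∀ {A B f g} → (∀ b → T (B b) → T (Adj b (f b))) →
                      (∀ b → T ((A ─ B) b) → T (Adj b (g b))) →
                      ∀ b → T (A b) → T (Adj b (override B f g b))
  override-adjacent {A} {B} {f} {g} adj₁ adj₂ b b∈A =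
    by-cases (B b) (adj₁ b) (λ b∉B → adj₂ b (∧-intro b∈A (¬T⇒T-not (B b) b∉B)))
    where
    by-cases : ∀ x → (T x → T (Adj b (f b))) → (¬ T x → T (Adj b (g b))) → T (Adj b (if x then f b else g b))
    by-cases true  yes′ _   = yes′ tt
    by-cases false _    no′ = no′ λ ()

  override-bounded : ∀ (A B : Fin m → Bool) (f g : Fin m → Fin K) k →
    ∣ A ∩ preimage (override B f g) k ∣ ≤ ∣ (A ∩ B) ∩ preimage f k ∣ + ∣ (A ─ B) ∩ preimage g k ∣
  override-bounded A B f g k = begin
    ∣ A ∩ preimage h k ∣                                     ≡⟨ weight-split (λ _ → 1) (A ∩ preimage h k) B ⟩
    ∣ (A ∩ preimage h k) ∩ B ∣ + ∣ (A ∩ preimage h k) ─ B ∣ ≤⟨ ℕP.+-mono-≤ (weight-mono-⊆ (λ _ → 1) inside)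
                                                                            (weight-mono-⊆ (λ _ → 1) outside) ⟩
    ∣ (A ∩ B) ∩ preimage f k ∣ + ∣ (A ─ B) ∩ preimage g k ∣  ∎
    where
    open ℕP.≤-Reasoning
    h = override B f g
    chosen : ∀ a x u v → T ((a ∧ does ((if x then u else v) ≟ k)) ∧ x) → T ((a ∧ x) ∧ does (u ≟ k))
    chosen true  true  u v p = subst T (∧-identityʳ _) p
    chosen true  false u v p = ⊥-elim (subst T (∧-zeroʳ _) p)
    skipped : ∀ a x u v → T ((a ∧ does ((if x then u else v) ≟ k)) ∧ not x) → T ((a ∧ not x) ∧ does (v ≟ k))
    skipped true  false u v p = subst T (∧-identityʳ _) p
    skipped true  true  u v p = ⊥-elim (subst T (∧-zeroʳ _) p)
    inside : (A ∩ preimage h k) ∩ B ⊆ (A ∩ B) ∩ preimage f k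
    inside b = chosen (A b) (B b) (f b) (g b)
    outside : (A ∩ preimage h k) ─ B ⊆ (A ─ B) ∩ preimage g k
    outside b = skipped (A b) (B b) (f b) (g b)

  empty-matching : ∀ A c → ∣ A ∣ ≡ 0 → Matching A c
  empty-matching A c ∣A∣≡0 = record
    { match    = fallback
    ; adjacent = λ b b∈A → ⊥-elim (absent b∈A)
    ; bounded  = λ k → ℕP.≤-trans (ℕP.≤-reflexive (weight-empty (λ _ → 1) {A ∩ preimage fallback k}
                                                                (λ b → absent ∘ proj₁ ∘ ∧-elim (A b)))) z≤n
    }
    where
    absent : ∀ {b} → ¬ T (A b)
    absent b∈A = ℕP.<-irrefl (sym ∣A∣≡0) (member⇒∣∣-positive A b∈A)

  Smaller : (Fin m → Bool) → Set
  Smaller A = ∀ A′ c′ → ∣ A′ ∣ < ∣ A ∣ → HallCondition A′ c′ → Matching A′ c′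

  Tight : (Fin m → Bool) → (Fin K → ℕ) → (Fin m → Bool) → Set
  Tight A c B = 0 < ∣ B ∣ × ∣ B ∣ < ∣ A ∣ × ∣ B ∣ ≡ weight c (neighbours B)

  tight? : ∀ A c B → Dec (Tight A c B)
  tight? A c B = (0 <? ∣ B ∣) ×-dec (∣ B ∣ <? ∣ A ∣) ×-dec (∣ B ∣ ℕP.≟ weight c (neighbours B))

  tight-cong : ∀ {A c B B′} → (∀ b → B b ≡ B′ b) → Tight A c B → Tight A c B′
  tight-cong {A} {c} B≗B′ (0<∣B∣ , ∣B∣<∣A∣ , tight) =
    subst (0 <_) ∣B∣≡∣B′∣ 0<∣B∣ , subst (_< ∣ A ∣) ∣B∣≡∣B′∣ ∣B∣<∣A∣ ,
    trans (sym ∣B∣≡∣B′∣) (trans tight (weight-cong c (neighbours-cong B≗B′)))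
    where
    ∣B∣≡∣B′∣ = weight-cong (λ _ → 1) B≗B′

  avoiding : (Fin K → Bool) → (Fin K → ℕ) → Fin K → ℕ
  avoiding X c k = if X k then 0 else c k

  weight-avoiding : ∀ X c Y → weight (avoiding X c) Y ≡ weight c (Y ─ X)
  weight-avoiding X c Y = sum-cong-≗ (λ k → pointwise (Y k) (X k) (c k))
    where
    pointwise : ∀ y x n → (if y then (if x then 0 else n) else 0) ≡ (if y ∧ not x then n else 0)
    pointwise true  true  n = refl
    pointwise true  false n = refl
    pointwise false x     n = refl

  hall-beyond-tight : ∀ {A B c} → HallCondition A c → B ⊆ A → ∣ B ∣ ≡ weight c (neighbours B) →
                      HallCondition (A ─ B) (avoiding (neighbours B) c)
  hall-beyond-tight {A} {B} {c} hall B⊆A tight D D⊆A─B = ℕP.+-cancelˡ-≤ ∣ B ∣ _ _ (begin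
    ∣ B ∣ + ∣ D ∣                                              ≡⟨ ∣∪∣-disjoint D B disjoint ⟨
    ∣ D ∪ B ∣                                                  ≤⟨ hall (D ∪ B) D∪B⊆A ⟩
    weight c N[D∪B]                                            ≡⟨ weight-split c N[D∪B] (neighbours B) ⟩
    weight c (N[D∪B] ∩ neighbours B) + weight c (N[D∪B] ─ neighbours B)
                                                               ≤⟨ ℕP.+-mono-≤ (weight-mono-⊆ c (λ k → proj₂ ∘ ∧-elim (N[D∪B] k)))
                                                                              (weight-mono-⊆ c fresh) ⟩
    weight c (neighbours B) + weight c (neighbours D ─ neighbours B)
                                                               ≡⟨ cong₂ _+_ tight (weight-avoiding (neighbours B) c (neighbours D)) ⟨
    ∣ B ∣ + weight (avoiding (neighbours B) c) (neighbours D)  ∎)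
    where
    open ℕP.≤-Reasoning
    N[D∪B] = neighbours (D ∪ B)
    disjoint : ∀ b → T (D b) → ¬ T (B b)
    disjoint b b∈D = T-not⇒¬T (B b) (proj₂ (∧-elim (A b) (D⊆A─B b b∈D)))
    D∪B⊆A : D ∪ B ⊆ A
    D∪B⊆A b b∈D∪B with Equivalence.to T-∨ b∈D∪B
    ... | inj₁ b∈D = proj₁ (∧-elim (A b) (D⊆A─B b b∈D))
    ... | inj₂ b∈B = B⊆A b b∈B
    fresh : N[D∪B] ─ neighbours B ⊆ neighbours D ─ neighbours B
    fresh k p with ∧-elim (N[D∪B] k) p
    ... | k∈N[D∪B] , k∉NB with Equivalence.to T-∨ (neighbours-∪ D B k k∈N[D∪B])
    ...   | inj₁ k∈ND = ∧-intro k∈ND k∉NB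
    ...   | inj₂ k∈NB = ⊥-elim (T-not⇒¬T (neighbours B k) k∉NB k∈NB)

  split-at-tight : ∀ {A c} → Smaller A → HallCondition A c → ∀ B → B ⊆ A → Tight A c B → Matching A c
  split-at-tight {A} {c} smaller hall B B⊆A (0<∣B∣ , ∣B∣<∣A∣ , tight) = record
    { match    = override B M₁.match M₂.match
    ; adjacent = override-adjacent M₁.adjacent M₂.adjacent
    ; bounded  = λ k → ℕP.≤-trans (override-bounded A B M₁.match M₂.match k)
                         (split-bound (neighbours B k) (inside-bound k) (M₂.bounded k))
    }
    where
    ∣A─B∣<∣A∣ : ∣ A ─ B ∣ < ∣ A ∣
    ∣A─B∣<∣A∣ = subst (∣ A ─ B ∣ <_) (sym (∣∣-split-⊆ A B B⊆A)) (ℕP.m<n+m _ 0<∣B∣)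
    module M₁ = Matching (smaller B c ∣B∣<∣A∣ (restrict B⊆A hall))
    module M₂ = Matching (smaller (A ─ B) (avoiding (neighbours B) c) ∣A─B∣<∣A∣ (hall-beyond-tight hall B⊆A tight))
    inside-bound : ∀ k → ∣ (A ∩ B) ∩ preimage M₁.match k ∣ ≤ (if neighbours B k then c k else 0)
    inside-bound k = by-cases (neighbours B k) inside-full inside-empty
      where
      members : ∀ b → T (((A ∩ B) ∩ preimage M₁.match k) b) → T (B b) × T (preimage M₁.match k b)
      members b p = proj₂ (∧-elim (A b) (proj₁ (∧-elim (A b ∧ B b) p))) , proj₂ (∧-elim (A b ∧ B b) p)
      inside-full : ∣ (A ∩ B) ∩ preimage M₁.match k ∣ ≤ c k
      inside-full = ℕP.≤-trans (weight-mono-⊆ (λ _ → 1) (λ b → uncurry ∧-intro ∘ members b)) (M₁.bounded k)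
      adjacent-to-k : ∀ b → T (B b) → T (preimage M₁.match k b) → T (neighbours B k)
      adjacent-to-k b b∈B b↦k = neighbours-intro b∈B (subst (T ∘ Adj b) (⁅⁆-sound b↦k) (M₁.adjacent b b∈B))
      inside-empty : ¬ T (neighbours B k) → ∣ (A ∩ B) ∩ preimage M₁.match k ∣ ≡ 0
      inside-empty k∉N = weight-empty (λ _ → 1) (λ b → k∉N ∘ uncurry (adjacent-to-k b) ∘ members b)
      by-cases : ∀ x → ∣ (A ∩ B) ∩ preimage M₁.match k ∣ ≤ c k → (¬ T x → ∣ (A ∩ B) ∩ preimage M₁.match k ∣ ≡ 0) →
                 ∣ (A ∩ B) ∩ preimage M₁.match k ∣ ≤ (if x then c k else 0)
      by-cases true  full _     = full
      by-cases false _    empty = ℕP.≤-reflexive (empty λ ())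
    split-bound : ∀ x {p q n} → p ≤ (if x then n else 0) → q ≤ (if x then 0 else n) → p + q ≤ n
    split-bound true  {n = n} p≤n q≤0 = ℕP.≤-trans (ℕP.+-mono-≤ p≤n q≤0) (ℕP.≤-reflexive (ℕP.+-identityʳ n))
    split-bound false         p≤0 q≤n = ℕP.+-mono-≤ p≤0 q≤n

  take-one : Fin K → (Fin K → ℕ) → Fin K → ℕ
  take-one k₀ c k = if ⁅ k₀ ⁆ k then c k ∸ 1 else c k

  weight-take-one : ∀ k₀ c X → weight c X ≤ weight (take-one k₀ c) X + 1
  weight-take-one k₀ c X = begin
    weight c X                                             ≤⟨ ∑ℕ-mono-≤ (λ k → pointwise (X k) (⁅ k₀ ⁆ k) (c k)) ⟩
    ∑[ k < K ] ((if X k then take-one k₀ c k else 0) + (if ⁅ k₀ ⁆ k then 1 else 0))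
                                                           ≡⟨ ∑-distrib-+ {K} _ _ ⟩
    weight (take-one k₀ c) X + ∣ ⁅ k₀ ⁆ ∣                  ≡⟨ cong (weight (take-one k₀ c) X +_) (∣⁅⁆∣ k₀) ⟩
    weight (take-one k₀ c) X + 1                           ∎
    where
    open ℕP.≤-Reasoning
    pointwise : ∀ x e n → (if x then n else 0) ≤ (if x then (if e then n ∸ 1 else n) else 0) + (if e then 1 else 0)
    pointwise true  true  n = ℕP.≤-trans (ℕP.m≤n+m∸n n 1) (ℕP.≤-reflexive (ℕP.+-comm 1 (n ∸ 1)))
    pointwise true  false n = ℕP.m≤m+n n 0
    pointwise false e     n = z≤n

  NoTight : (Fin m → Bool) → (Fin K → ℕ) → Set
  NoTight A c = ∀ B → B ⊆ A → ¬ Tight A c B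

  hall-taking-one : ∀ {A c b₀} k₀ → HallCondition A c → NoTight A c → T (A b₀) →
                    HallCondition (A ─ ⁅ b₀ ⁆) (take-one k₀ c)
  hall-taking-one {A} {c} {b₀} k₀ hall no-tight b₀∈A D D⊆A′ with ∣ D ∣ ℕP.≟ 0
  ... | yes ∣D∣≡0 = subst (_≤ weight (take-one k₀ c) (neighbours D)) (sym ∣D∣≡0) z≤n
  ... | no ∣D∣≢0  = ℕP.≤-pred (begin
    suc ∣ D ∣                                   ≤⟨ ℕP.≤∧≢⇒< (hall D D⊆A) (λ tight → no-tight D D⊆A (0<∣D∣ , ∣D∣<∣A∣ , tight)) ⟩
    weight c (neighbours D)                     ≤⟨ weight-take-one k₀ c (neighbours D) ⟩
    weight (take-one k₀ c) (neighbours D) + 1   ≡⟨ ℕP.+-comm _ 1 ⟩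
    suc (weight (take-one k₀ c) (neighbours D)) ∎)
    where
    open ℕP.≤-Reasoning
    0<∣D∣ = ℕP.n≢0⇒n>0 ∣D∣≢0
    D⊆A : D ⊆ A
    D⊆A b b∈D = proj₁ (∧-elim (A b) (D⊆A′ b b∈D))
    ∣D∣<∣A∣ : ∣ D ∣ < ∣ A ∣
    ∣D∣<∣A∣ = subst (∣ D ∣ <_) (sym (∣∣-remove A b₀∈A)) (s≤s (weight-mono-⊆ (λ _ → 1) D⊆A′))

  match-one : ∀ {A c} → Smaller A → HallCondition A c → NoTight A c → 0 < ∣ A ∣ → Matching A c
  match-one {A} {c} smaller hall no-tight 0<∣A∣ = record
    { match    = override ⁅ b₀ ⁆ (λ _ → k₀) M.match
    ; adjacent = override-adjacent (λ b b₀≡b → subst (λ b → T (Adj b k₀)) (⁅⁆-sound b₀≡b) b₀~k₀) M.adjacent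
    ; bounded  = λ k → ℕP.≤-trans (override-bounded A ⁅ b₀ ⁆ (λ _ → k₀) M.match k)
                         (combine (⁅ k₀ ⁆ k) (λ k₀≡k → subst (λ k → 0 < c k) (⁅⁆-sound k₀≡k) 0<c[k₀]) (single k) (M.bounded k))
    }
    where
    b₀ = proj₁ (weight-positive (λ _ → 1) A 0<∣A∣)
    b₀∈A : T (A b₀)
    b₀∈A = proj₁ (proj₂ (weight-positive (λ _ → 1) A 0<∣A∣))
    k₀ = proj₁ (reachable hall b₀∈A)
    b₀~k₀ : T (Adj b₀ k₀)
    b₀~k₀ = proj₁ (proj₂ (reachable hall b₀∈A))
    0<c[k₀] : 0 < c k₀
    0<c[k₀] = proj₂ (proj₂ (reachable hall b₀∈A))
    module M = Matching (smaller (A ─ ⁅ b₀ ⁆) (take-one k₀ c) (ℕP.≤-reflexive (sym (∣∣-remove A b₀∈A)))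
                                (hall-taking-one k₀ hall no-tight b₀∈A))
    single : ∀ k → ∣ (A ∩ ⁅ b₀ ⁆) ∩ preimage (λ _ → k₀) k ∣ ≤ (if ⁅ k₀ ⁆ k then 1 else 0)
    single k = by-cases (⁅ k₀ ⁆ k)
      where
      by-cases : ∀ e → ∣ (A ∩ ⁅ b₀ ⁆) ∩ (λ _ → e) ∣ ≤ (if e then 1 else 0)
      by-cases true  = ℕP.≤-trans (weight-mono-⊆ (λ _ → 1) {_} {⁅ b₀ ⁆} (λ b → proj₂ ∘ ∧-elim (A b) ∘ proj₁ ∘ ∧-elim (A b ∧ ⁅ b₀ ⁆ b)))
                                  (ℕP.≤-reflexive (∣⁅⁆∣ b₀))
      by-cases false = ℕP.≤-reflexive (weight-empty (λ _ → 1) {(A ∩ ⁅ b₀ ⁆) ∩ (λ _ → false)}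
                                                   (λ b p → subst T (∧-zeroʳ (A b ∧ ⁅ b₀ ⁆ b)) p))
    combine : ∀ e {p q n} → (T e → 0 < n) → p ≤ (if e then 1 else 0) → q ≤ (if e then n ∸ 1 else n) → p + q ≤ n
    combine true  {n = n} 0<n p≤1 q≤n∸1 = ℕP.≤-trans (ℕP.+-mono-≤ p≤1 q≤n∸1) (ℕP.≤-reflexive (ℕP.m+[n∸m]≡n (0<n tt)))
    combine false         _   p≤0 q≤n   = ℕP.+-mono-≤ p≤0 q≤n

  -- Halmos–Vaughan induction on ∣ A ∣: split along a tight proper subset if there is one,
  -- otherwise every proper subset has slack and any one edge can be committed.
  hall-bounded : ∀ s A c → ∣ A ∣ ≤ s → HallCondition A c → Matching A c
  hall-bounded s A c ∣A∣≤s hall with ∣ A ∣ ℕP.≟ 0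
  ... | yes ∣A∣≡0 = empty-matching A c ∣A∣≡0
  hall-bounded zero    A c ∣A∣≤0   hall | no ∣A∣≢0 = ⊥-elim (∣A∣≢0 (ℕP.n≤0⇒n≡0 ∣A∣≤0))
  hall-bounded (suc s) A c ∣A∣≤1+s hall | no ∣A∣≢0 = by-tightness (anySubset? (λ v → tight? A c (A ∩ lookup v)))
    where
    smaller : Smaller A
    smaller A′ c′ ∣A′∣<∣A∣ = hall-bounded s A′ c′ (ℕP.≤-pred (ℕP.≤-trans ∣A′∣<∣A∣ ∣A∣≤1+s))
    as-subset : ∀ {B} → B ⊆ A → ∀ b → B b ≡ (A ∩ lookup (tabulate B)) b
    as-subset {B} B⊆A b = sym (trans (cong (A b ∧_) (lookup∘tabulate B b))
                                     (T-injective (proj₂ ∘ ∧-elim (A b)) (λ b∈B → ∧-intro (B⊆A b b∈B) b∈B)))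
    by-tightness : Dec (∃ λ v → Tight A c (A ∩ lookup v)) → Matching A c
    by-tightness (yes (v , tight)) = split-at-tight smaller hall (A ∩ lookup v) (λ b → proj₁ ∘ ∧-elim (A b)) tight
    by-tightness (no none)         = match-one smaller hall (λ B B⊆A tight → none (tabulate B , tight-cong (as-subset B⊆A) tight))
                                                (ℕP.n≢0⇒n>0 ∣A∣≢0)

  hall : ∀ A c → HallCondition A c → Matching A c
  hall A c = hall-bounded ∣ A ∣ A c ℕP.≤-refl

module Counting where

  open import Data.Rational using (_+_; _*_)
  open Sums
  open Subsets using (weight; ∣_∣; preimage)

  ι-weight : ∀ {n} (c : Fin n → ℕ) (A : Fin n → Bool) → ι (weight c A) ≡ ∑[ i < n ] (ind (A i) * ι (c i))
  ι-weight {n} c A = trans (ι-∑ {n} (λ i → if A i then c i else 0)) (sum-cong-≗ (λ i → pointwise (A i) (c i)))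
    where
    pointwise : ∀ x k → ι (if x then k else 0) ≡ ind x * ι k
    pointwise true  k = sym (ℚP.*-identityˡ (ι k))
    pointwise false k = sym (ℚP.*-zeroˡ (ι k))

  ι-∣∣ : ∀ {n} (A : Fin n → Bool) → ι ∣ A ∣ ≡ ∑[ i < n ] ind (A i)
  ι-∣∣ A = trans (ι-weight _ A) (sum-cong-≗ (λ i → ℚP.*-identityʳ (ind (A i))))

  ∑-preimage : ∀ {m K} (f : Fin m → Fin K) (g : Fin K → ℚ) →
               ∑[ b < m ] g (f b) ≡ ∑[ t < K ] (ι ∣ preimage f t ∣ * g t)
  ∑-preimage {m} {K} f g = begin
    ∑[ b < m ] g (f b)                                  ≡⟨ sum-cong-≗ (λ b → ∑-δ (f b) g) ⟨
    ∑[ b < m ] ∑[ t < K ] (ind (preimage f t b) * g t)  ≡⟨ ∑-comm {m} {K} (λ b t → ind (preimage f t b) * g t) ⟩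
    ∑[ t < K ] ∑[ b < m ] (ind (preimage f t b) * g t)  ≡⟨ sum-cong-≗ (λ t → *-distribʳ-sum {m} (g t) (λ b → ind (preimage f t b))) ⟨
    ∑[ t < K ] (∑[ b < m ] ind (preimage f t b) * g t)  ≡⟨ sum-cong-≗ (λ t → cong (_* g t) (ι-∣∣ (preimage f t))) ⟨
    ∑[ t < K ] (ι ∣ preimage f t ∣ * g t)               ∎
    where open ≡-Reasoning

module Rounding {m K : ℕ} (μ : Fin m → Fin K → ℚ) (μ≥0 : ∀ b k → 0ℚ ℚ.≤ μ b k)
                (row-sum : ∀ b → ℚΣ.sum (μ b) ≡ 1ℚ) (capacity : Fin K → ℕ)
                (column-sum : ∀ k → ℚΣ.sum (λ b → μ b k) ≡ Sums.ι (capacity k)) where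

  open import Data.Rational using (_+_; _*_; _≤_; _<_)
  open Sums
  open Subsets using (weight; ∣_∣; preimage)
  open Counting

  supported : Fin m → Fin K → Bool
  supported b k = does (0ℚ ℚP.<? μ b k)

  fallback : Fin m → Fin K
  fallback b = proj₁ (∑-positive⇒∃ (μ b) (subst (0ℚ <_) (sym (row-sum b)) (ℚP.positive⁻¹ 1ℚ)))

  open Hall supported fallback

  through-neighbours : ∀ B k → ∑[ b < m ] (ind (B b) * μ b k) ≤ ind (neighbours B k) * ι (capacity k)
  through-neighbours B k = by-cases (neighbours B k) (λ k∉N b b∈B b~k → k∉N (neighbours-intro b∈B b~k))
    where
    at-most : ∀ x {q} → 0ℚ ≤ q → ind x * q ≤ q
    at-most true  {q} _   = ℚP.≤-reflexive (ℚP.*-identityˡ q)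
    at-most false {q} 0≤q = ℚP.≤-trans (ℚP.≤-reflexive (ℚP.*-zeroˡ q)) 0≤q
    vanishing : ∀ x b → (T x → ¬ T (supported b k)) → ind x * μ b k ≤ 0ℚ
    vanishing true  b unsupported = ℚP.≤-trans (ℚP.≤-reflexive (ℚP.*-identityˡ (μ b k)))
                                      (ℚP.≮⇒≥ (unsupported tt ∘ does-complete (0ℚ ℚP.<? μ b k)))
    vanishing false b _           = ℚP.≤-reflexive (ℚP.*-zeroˡ (μ b k))
    by-cases : ∀ x → (¬ T x → ∀ b → T (B b) → ¬ T (supported b k)) →
               ∑[ b < m ] (ind (B b) * μ b k) ≤ ind x * ι (capacity k)
    by-cases true  _        = ℚP.≤-trans (∑-mono-≤ (λ b → at-most (B b) (μ≥0 b k)))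
                                (ℚP.≤-reflexive (trans (column-sum k) (sym (ℚP.*-identityˡ (ι (capacity k))))))
    by-cases false isolated = ℚP.≤-trans (∑-mono-≤ (λ b → vanishing (B b) b (isolated (λ ()) b)))
                                (ℚP.≤-reflexive (trans (sum-replicate-zero m) (sym (ℚP.*-zeroˡ (ι (capacity k))))))

  hall-condition : HallCondition (λ _ → true) capacity
  hall-condition B _ = ι-cancel-≤ (begin
    ι ∣ B ∣                                           ≡⟨ ι-∣∣ B ⟩
    ∑[ b < m ] ind (B b)                              ≡⟨ sum-cong-≗ (λ b → trans (cong (ind (B b) *_) (row-sum b))
                                                                                 (ℚP.*-identityʳ (ind (B b)))) ⟨
    ∑[ b < m ] (ind (B b) * ∑[ k < K ] μ b k)         ≡⟨ sum-cong-≗ (λ b → *-distribˡ-sum (ind (B b)) (μ b)) ⟩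
    ∑[ b < m ] ∑[ k < K ] (ind (B b) * μ b k)         ≡⟨ ∑-comm {m} {K} (λ b k → ind (B b) * μ b k) ⟩
    ∑[ k < K ] ∑[ b < m ] (ind (B b) * μ b k)         ≤⟨ ∑-mono-≤ (through-neighbours B) ⟩
    ∑[ k < K ] (ind (neighbours B k) * ι (capacity k)) ≡⟨ ι-weight capacity (neighbours B) ⟨
    ι (weight capacity (neighbours B))                ∎)
    where open ℚP.≤-Reasoning

  module M = Matching (hall (λ _ → true) capacity hall-condition)

  load-total : ∑[ k < K ] ι ∣ preimage M.match k ∣ ≡ ∑[ k < K ] ι (capacity k)
  load-total = begin
    ∑[ k < K ] ι ∣ preimage M.match k ∣          ≡⟨ sum-cong-≗ (λ k → ℚP.*-identityʳ (ι ∣ preimage M.match k ∣)) ⟨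
    ∑[ k < K ] (ι ∣ preimage M.match k ∣ * 1ℚ)   ≡⟨ ∑-preimage M.match (λ _ → 1ℚ) ⟨
    ∑[ b < m ] 1ℚ                                ≡⟨ sum-cong-≗ row-sum ⟨
    ∑[ b < m ] ∑[ k < K ] μ b k                  ≡⟨ ∑-comm {m} {K} μ ⟩
    ∑[ k < K ] ∑[ b < m ] μ b k                  ≡⟨ sum-cong-≗ column-sum ⟩
    ∑[ k < K ] ι (capacity k)                    ∎
    where open ≡-Reasoning

  integral-assignment : ∃ λ (f : Fin m → Fin K) → (∀ b → 0ℚ < μ b (f b)) × (∀ k → ∣ preimage f k ∣ ≡ capacity k)
  integral-assignment =
    M.match ,
    (λ b → does-sound (0ℚ ℚP.<? μ b (M.match b)) (M.adjacent b tt)) ,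
    (λ k → ι-injective (∑-≤-≡⇒≡ (λ k → ι-mono-≤ (M.bounded k)) load-total k))

module Geometry where

  open import Data.Rational using (_+_; _*_; _≤_)
  open Sums
  open +-*-Solver using (solve; _:+_; _:*_; _:=_)

  -- Defs keeps the edge term of `dot` in a where-block: unification names it edgeProduct here,
  -- and `with i FinP.<? j` then evaluates it.
  mutual
    edgeProduct : ∀ {n} → Vect n → Vect n → Fin n → Fin n → ℚ
    edgeProduct = _

    dot-unfold : ∀ {n} (x y : Vect n) →
                 dot x y ≡ sumFin (λ i → proj₁ x i * proj₁ y i) + sumFin (λ i → sumFin (edgeProduct x y i))
    dot-unfold x y = refl

  module _ {n : ℕ} where

    vertexPart edgePart : Vect n → Vect n → ℚ
    vertexPart x y = ∑[ i < n ] (proj₁ x i * proj₁ y i)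
    edgePart   x y = ∑[ i < n ] ∑[ j < n ] edgeProduct x y i j

    dot-expansion : ∀ x y → dot x y ≡ vertexPart x y + edgePart x y
    dot-expansion x y = trans (dot-unfold x y)
      (cong₂ _+_ (sumFin≡∑ (λ i → proj₁ x i * proj₁ y i))
        (trans (sumFin≡∑ (λ i → sumFin (edgeProduct x y i))) (sum-cong-≗ (λ i → sumFin≡∑ (edgeProduct x y i)))))

    ∑-linear : ∀ {k} s (f g : Fin k → ℚ) → ∑[ i < k ] (s * f i + g i) ≡ s * ∑[ i < k ] f i + ∑[ i < k ] g i
    ∑-linear {k} s f g = trans (∑-distrib-+ {k} (λ i → s * f i) g) (cong (_+ ∑[ i < k ] g i) (sym (*-distribˡ-sum s f)))

    dot-linear : ∀ c s x y → dot c ((s ·V x) +V y) ≡ s * dot c x + dot c y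
    dot-linear c s x y = begin
      dot c ((s ·V x) +V y)                                    ≡⟨ dot-expansion c ((s ·V x) +V y) ⟩
      vertexPart c ((s ·V x) +V y) + edgePart c ((s ·V x) +V y) ≡⟨ cong₂ _+_ vertices edges ⟩
      (s * vertexPart c x + vertexPart c y) + (s * edgePart c x + edgePart c y)
                                                                 ≡⟨ regroup s (vertexPart c x) (vertexPart c y) (edgePart c x) (edgePart c y) ⟩
      s * (vertexPart c x + edgePart c x) + (vertexPart c y + edgePart c y)
                                                               ≡⟨ cong₂ (λ u v → s * u + v) (dot-expansion c x) (dot-expansion c y) ⟨
      s * dot c x + dot c y                                    ∎
      where
      open ≡-Reasoning
      distribute : ∀ a u v → a * (s * u + v) ≡ s * (a * u) + a * v
      distribute = solve 4 (λ s a u v → a :* (s :* u :+ v) := s :* (a :* u) :+ a :* v) refl s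
      regroup : ∀ s a b c d → (s * a + b) + (s * c + d) ≡ s * (a + c) + (b + d)
      regroup = solve 5 (λ s a b c d → (s :* a :+ b) :+ (s :* c :+ d) := s :* (a :+ c) :+ (b :+ d)) refl
      vertices : vertexPart c ((s ·V x) +V y) ≡ s * vertexPart c x + vertexPart c y
      vertices = trans (sum-cong-≗ (λ i → distribute (proj₁ c i) (proj₁ x i) (proj₁ y i)))
                       (∑-linear s (λ i → proj₁ c i * proj₁ x i) (λ i → proj₁ c i * proj₁ y i))
      edge : ∀ i j → edgeProduct c ((s ·V x) +V y) i j ≡ s * edgeProduct c x i j + edgeProduct c y i j
      edge i j with i FinP.<? j
      ... | yes _ = distribute (proj₂ c i j) (proj₂ x i j) (proj₂ y i j)
      ... | no _  = sym (trans (ℚP.+-identityʳ (s * 0ℚ)) (ℚP.*-zeroʳ s))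
      edges : edgePart c ((s ·V x) +V y) ≡ s * edgePart c x + edgePart c y
      edges = trans (sum-cong-≗ (λ i → trans (sum-cong-≗ (edge i)) (∑-linear s (edgeProduct c x i) (edgeProduct c y i))))
                    (∑-linear s (λ i → ∑[ j < n ] edgeProduct c x i j) (λ i → ∑[ j < n ] edgeProduct c y i j))

    dot-zeroV : ∀ c → dot c zeroV ≡ 0ℚ
    dot-zeroV c = begin
      dot c zeroV                              ≡⟨ dot-expansion c zeroV ⟩
      vertexPart c zeroV + edgePart c zeroV    ≡⟨ cong₂ _+_ (∑-zero {n} (λ i → ℚP.*-zeroʳ (proj₁ c i)))
                                                            (∑-zero {n} (λ i → ∑-zero {n} (edge i))) ⟩
      0ℚ + 0ℚ                                  ≡⟨ ℚP.+-identityʳ 0ℚ ⟩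
      0ℚ                                       ∎
      where
      open ≡-Reasoning
      edge : ∀ i j → edgeProduct c zeroV i j ≡ 0ℚ
      edge i j with i FinP.<? j
      ... | yes _ = ℚP.*-zeroʳ (proj₂ c i j)
      ... | no _  = refl

    dot-cong : ∀ c {x y} → x ≈V y → dot c x ≡ dot c y
    dot-cong c {x} {y} (vertex≡ , edge≡) = begin
      dot c x                              ≡⟨ dot-expansion c x ⟩
      vertexPart c x + edgePart c x        ≡⟨ cong₂ _+_ (sum-cong-≗ (λ i → cong (proj₁ c i *_) (vertex≡ i)))
                                                        (sum-cong-≗ (λ i → sum-cong-≗ (edge i))) ⟩
      vertexPart c y + edgePart c y        ≡⟨ dot-expansion c y ⟨
      dot c y                              ∎
      where
      open ≡-Reasoning
      edge : ∀ i j → edgeProduct c x i j ≡ edgeProduct c y i j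
      edge i j with i FinP.<? j
      ... | yes i<j = cong (proj₂ c i j *_) (edge≡ i j i<j)
      ... | no _    = refl

    dot-∑ : ∀ c {k} (w : Fin k → ℚ) (x : Fin k → Vect n) →
            dot c (sumV (λ t → w t ·V x t)) ≡ ∑[ t < k ] (w t * dot c (x t))
    dot-∑ c {ℕ.zero}  w x = dot-zeroV c
    dot-∑ c {ℕ.suc k} w x = trans (dot-linear c (w zero) (x zero) _)
                                  (cong (w zero * dot c (x zero) +_) (dot-∑ c (w ∘ suc) (x ∘ suc)))

  record ConvexCombination (n : ℕ) : Set where
    field
      size         : ℕ
      coeff        : Fin size → ℚ
      vertex       : Fin size → Subset n
      coeff-nonneg : ∀ k → 0ℚ ≤ coeff k
      coeff-sum    : ∑[ k < size ] coeff k ≡ 1ℚ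

    point : Vect n
    point = sumV (λ k → coeff k ·V aS (vertex k))

  open ConvexCombination

  combo-sumV : ∀ {n} (L : List (ℚ × Subset n)) →
               combo L ≡ sumV (λ k → proj₁ (List.lookup L k) ·V aS (proj₂ (List.lookup L k)))
  combo-sumV []            = refl
  combo-sumV ((w , S) ∷ L) = cong ((w ·V aS S) +V_) (combo-sumV L)

  weightSum-∑ : ∀ {n} (L : List (ℚ × Subset n)) → weightSum L ≡ ∑[ k < length L ] proj₁ (List.lookup L k)
  weightSum-∑ []            = refl
  weightSum-∑ ((w , S) ∷ L) = cong (w +_) (weightSum-∑ L)

  convex-representation : ∀ {n} {y : Vect n} → InP y → Σ (ConvexCombination n) λ C → y ≈V point C
  convex-representation {y = y} (L , nonneg , total , y≈L) = C , subst (y ≈V_) (combo-sumV L) y≈L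
    where
    C = record
      { size         = length L
      ; coeff        = λ k → proj₁ (List.lookup L k)
      ; vertex       = λ k → proj₂ (List.lookup L k)
      ; coeff-nonneg = λ k → All.lookup nonneg (∈-lookup k)
      ; coeff-sum    = trans (sym (weightSum-∑ L)) total
      }

  vertex-in-P : ∀ {n} (S : Subset n) → InP (aS S)
  vertex-in-P S = ((1ℚ , S) ∷ []) , (ℚP.nonNegative⁻¹ 1ℚ ∷ []) , ℚP.+-identityʳ 1ℚ ,
                  (λ i → sym (unit (ind (lookup S i)))) , (λ i j _ → sym (unit (ind (lookup S i ∧ lookup S j))))
    where
    unit : ∀ q → 1ℚ * q + 0ℚ ≡ q
    unit q = trans (ℚP.+-identityʳ (1ℚ * q)) (ℚP.*-identityˡ q)

  face-support : ∀ {n} {c y : Vect n} (C : ConvexCombination n) → InFace c y → y ≈V point C →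
                 ∀ k → 0ℚ ℚ.< coeff C k → IsVertexOfFace c (vertex C k)
  face-support {n} {c} {y} C (_ , maximal) y≈C k 0<coeff =
    vertex-in-P (vertex C k) , λ T → ℚP.≤-trans (maximal T) (ℚP.≤-reflexive (sym (tight k 0<coeff)))
    where
    open ≡-Reasoning
    value : Fin (size C) → ℚ
    value k = dot c (aS (vertex C k))
    balance : ∑[ k < size C ] (coeff C k * value k) ≡ ∑[ k < size C ] (coeff C k * dot c y)
    balance = begin
      ∑[ k < size C ] (coeff C k * value k) ≡⟨ dot-∑ c (coeff C) (aS ∘ vertex C) ⟨
      dot c (point C)                       ≡⟨ dot-cong c y≈C ⟨
      dot c y                               ≡⟨ ℚP.*-identityˡ (dot c y) ⟨
      1ℚ * dot c y                          ≡⟨ cong (_* dot c y) (coeff-sum C) ⟨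
      ∑[ k < size C ] coeff C k * dot c y   ≡⟨ *-distribʳ-sum (dot c y) (coeff C) ⟩
      ∑[ k < size C ] (coeff C k * dot c y) ∎
    tight : ∀ k → 0ℚ ℚ.< coeff C k → value k ≡ dot c y
    tight = ∑-weighted-tight (coeff C) value (λ _ → dot c y) (coeff-nonneg C) (λ k → maximal (vertex C k)) balance

  sumV-vertex : ∀ {n k} (f : Fin k → Vect n) i → proj₁ (sumV f) i ≡ ∑[ b < k ] proj₁ (f b) i
  sumV-vertex {k = ℕ.zero}  f i = refl
  sumV-vertex {k = ℕ.suc k} f i = cong (proj₁ (f zero) i +_) (sumV-vertex (f ∘ suc) i)

  sumV-edge : ∀ {n k} (f : Fin k → Vect n) i j → proj₂ (sumV f) i j ≡ ∑[ b < k ] proj₂ (f b) i j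
  sumV-edge {k = ℕ.zero}  f i j = refl
  sumV-edge {k = ℕ.suc k} f i j = cong (proj₂ (f zero) i j +_) (sumV-edge (f ∘ suc) i j)

  unitList : ∀ {n k} → (Fin k → Subset n) → List (ℚ × Subset n)
  unitList {k = ℕ.zero}  S = []
  unitList {k = ℕ.suc k} S = (1ℚ , S zero) ∷ unitList (S ∘ suc)

  unitList-nonneg : ∀ {n k} (S : Fin k → Subset n) → All (λ p → 0ℚ ≤ proj₁ p) (unitList S)
  unitList-nonneg {k = ℕ.zero}  S = []
  unitList-nonneg {k = ℕ.suc k} S = ℚP.nonNegative⁻¹ 1ℚ ∷ unitList-nonneg (S ∘ suc)

  unitList-weight : ∀ {n k} (S : Fin k → Subset n) → weightSum (unitList S) ≡ ι k
  unitList-weight {k = ℕ.zero}  S = refl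
  unitList-weight {k = ℕ.suc k} S = trans (cong (1ℚ +_) (unitList-weight (S ∘ suc))) (sym (ι-+ 1 k))

  unitList-≈ : ∀ {n k} (S : Fin k → Subset n) → sumV (λ b → aS (S b)) ≈V combo (unitList S)
  unitList-≈ {k = ℕ.zero}  S = (λ i → refl) , (λ i j _ → refl)
  unitList-≈ {k = ℕ.suc k} S =
    (λ i → cong₂ _+_ (sym (ℚP.*-identityˡ (ind (lookup (S zero) i)))) (proj₁ (unitList-≈ (S ∘ suc)) i)) ,
    (λ i j i<j → cong₂ _+_ (sym (ℚP.*-identityˡ (ind (lookup (S zero) i ∧ lookup (S zero) j))))
                           (proj₂ (unitList-≈ (S ∘ suc)) i j i<j))

  vertices-in-dilate : ∀ {n k} {x : Vect n} (S : Fin k → Subset n) → x ≈V sumV (λ b → aS (S b)) → InDilate (ι k) x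
  vertices-in-dilate S (vertex≡ , edge≡) =
    unitList S , unitList-nonneg S , unitList-weight S ,
    (λ i → trans (vertex≡ i) (proj₁ (unitList-≈ S) i)) ,
    (λ i j i<j → trans (edge≡ i j i<j) (proj₂ (unitList-≈ S) i j i<j))

  point-vertex : ∀ {n} (C : ConvexCombination n) i →
                 proj₁ (point C) i ≡ ∑[ k < size C ] (coeff C k * ind (lookup (vertex C k) i))
  point-vertex C i = sumV-vertex (λ k → coeff C k ·V aS (vertex C k)) i

  point-edge : ∀ {n} (C : ConvexCombination n) i j →
               proj₂ (point C) i j ≡ ∑[ k < size C ] (coeff C k * ind (lookup (vertex C k) i ∧ lookup (vertex C k) j))
  point-edge C i j = sumV-edge (λ k → coeff C k ·V aS (vertex C k)) i j

module Staircase {n m : ℕ} (a* : Fin n → ℕ) (a*≤m : ∀ i → a* i ℕ.≤ m) where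

  open import Data.Rational using (_+_; _*_)
  open Sums
  open Geometry using (sumV-vertex; sumV-edge; vertices-in-dilate)

  target : ZVect n
  target = (λ i → ℤ.+ a* i) , (λ i j → ℤ.+ (a* i ⊓ a* j))

  level : ℕ → Subset n
  level θ = tabulate (λ i → θ ≤ᵇ a* i)

  module _ {k} (S : Fin k → Subset n) (θ : Fin k → ℕ) (S-level : ∀ b i → lookup (S b) i ≡ (θ b ≤ᵇ a* i))
           (counts : ∀ i → ∑[ b < k ] ind (θ b ≤ᵇ a* i) ≡ ι (a* i)) where

    staircase-vertex : ∀ i → ∑[ b < k ] ind (lookup (S b) i) ≡ ι (a* i)
    staircase-vertex i = trans (sum-cong-≗ (λ b → cong ind (S-level b i))) (counts i)

    staircase-edge : ∀ i j → ∑[ b < k ] ind (lookup (S b) i ∧ lookup (S b) j) ≡ ι (a* i ⊓ a* j)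
    staircase-edge i j = trans (sum-cong-≗ (λ b → cong ind (trans (cong₂ _∧_ (S-level b i) (S-level b j))
                                                                     (≤ᵇ-⊓ (θ b) (a* i) (a* j)))))
                               (counts-⊓ (ℕP.⊓-sel (a* i) (a* j)))
      where
      counts-⊓ : a* i ⊓ a* j ≡ a* i ⊎ a* i ⊓ a* j ≡ a* j → ∑[ b < k ] ind (θ b ≤ᵇ a* i ⊓ a* j) ≡ ι (a* i ⊓ a* j)
      counts-⊓ (inj₁ ≡a*i) rewrite ≡a*i = counts i
      counts-⊓ (inj₂ ≡a*j) rewrite ≡a*j = counts j

    staircase-sum : toℚV target ≈V sumV (λ b → aS (S b))
    staircase-sum = (λ i → sym (trans (sumV-vertex (λ b → aS (S b)) i) (staircase-vertex i)))
                  , (λ i j _ → sym (trans (sumV-edge (λ b → aS (S b)) i j) (staircase-edge i j)))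

  target-in-dilate : InDilate (ι m) (toℚV target)
  target-in-dilate = vertices-in-dilate {k = m} (λ t → level (suc (toℕ t)))
    (staircase-sum {m} (λ t → level (suc (toℕ t))) (λ t → suc (toℕ t))
                   (λ t → lookup∘tabulate (λ i → suc (toℕ t) ≤ᵇ a* i)) (λ i → ∑-≤ᵇ {m} (a* i) (a*≤m i)))

  threshold : Subset n → ℕ
  threshold = least a* m

  IsBreakpoint : ℕ → Set
  IsBreakpoint s = s ≡ m ⊎ ∃ λ j → a* j ≡ s

  breakpoint? : ∀ s → Dec (IsBreakpoint s)
  breakpoint? s = (s ℕP.≟ m) ⊎-dec any? (λ j → a* j ℕP.≟ s)

  threshold-breakpoint : ∀ S → IsBreakpoint (threshold S)
  threshold-breakpoint S with least-attained a* m S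
  ... | inj₁ ≡m              = inj₁ ≡m
  ... | inj₂ (j , _ , ≡a*j)  = inj₂ (j , sym ≡a*j)

  record IsLevel (S : Subset n) : Set where
    field
      threshold-positive : 1 ℕ.≤ threshold S
      membership         : ∀ i → lookup S i ≡ (threshold S ≤ᵇ a* i)

  is-level : ∀ {S} → 1 ℕ.≤ m →
             (∀ i → a* i ≡ 0 → ¬ T (lookup S i)) → (∀ i → a* i ≡ m → T (lookup S i)) →
             (∀ i j → a* i ℕ.≤ a* j → T (lookup S i) → T (lookup S j)) → IsLevel S
  is-level {S} 1≤m avoids-zero contains-top upward =
    record { threshold-positive = positive ; membership = λ i → T-injective (into i) (out-of i) }
    where
    positive : 1 ℕ.≤ threshold S
    positive with least-attained a* m S
    ... | inj₁ ≡m                = subst (1 ℕ.≤_) (sym ≡m) 1≤m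
    ... | inj₂ (j , j∈S , ≡a*j)  = subst (1 ℕ.≤_) (sym ≡a*j) (ℕP.n≢0⇒n>0 (λ a*j≡0 → avoids-zero j a*j≡0 j∈S))
    into : ∀ i → T (lookup S i) → T (threshold S ≤ᵇ a* i)
    into i i∈S = ℕP.≤⇒≤ᵇ (least-≤-member a* m S i∈S)
    out-of : ∀ i → T (threshold S ≤ᵇ a* i) → T (lookup S i)
    out-of i p with least-attained a* m S
    ... | inj₁ ≡m                = contains-top i (ℕP.≤-antisym (a*≤m i) (subst (ℕ._≤ a* i) ≡m (ℕP.≤ᵇ⇒≤ _ _ p)))
    ... | inj₂ (j , j∈S , ≡a*j)  = upward j i (subst (ℕ._≤ a* i) ≡a*j (ℕP.≤ᵇ⇒≤ _ _ p)) j∈S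

  breakpoint-below : ℕ → ℕ
  breakpoint-below zero = zero
  breakpoint-below (suc s) with breakpoint? (suc s)
  ... | yes _ = suc s
  ... | no _  = breakpoint-below s

  breakpoint-below-≤ : ∀ s → breakpoint-below s ℕ.≤ s
  breakpoint-below-≤ zero = z≤n
  breakpoint-below-≤ (suc s) with breakpoint? (suc s)
  ... | yes _ = ℕP.≤-refl
  ... | no _  = ℕP.m≤n⇒m≤1+n (breakpoint-below-≤ s)

  breakpoint-below-step : ∀ s → breakpoint-below s ℕ.≤ breakpoint-below (suc s)
  breakpoint-below-step s with breakpoint? (suc s)
  ... | yes _ = ℕP.m≤n⇒m≤1+n (breakpoint-below-≤ s)
  ... | no _  = ℕP.≤-refl

  breakpoint-below-a* : ∀ i → breakpoint-below (a* i) ≡ a* i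
  breakpoint-below-a* i with a* i in a*i≡
  ... | zero  = refl
  ... | suc s with breakpoint? (suc s)
  ...   | yes _     = refl
  ...   | no ¬breakpoint = ⊥-elim (¬breakpoint (inj₂ (i , a*i≡)))

  gap : ℕ → ℕ
  gap s = breakpoint-below (suc s) ∸ breakpoint-below s

  ι-gap : ∀ s → ι (breakpoint-below (suc s)) ≡ ι (gap s) + ι (breakpoint-below s)
  ι-gap s = sym (ι-∸ (breakpoint-below-step s))

module Decomposition {n m : ℕ} (1≤m : 1 ℕ.≤ m) (a* : Fin n → ℕ) (a*≤m : ∀ i → a* i ℕ.≤ m)
                     (c y : Fin m → Vect n) (faces : ∀ b → InFace (c b) (y b))
                     (decomposed : toℚV (Staircase.target a* a*≤m) ≈V sumV y) where

  open import Data.Rational using (_+_; _*_; _≤_; _<_)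
  open Sums
  open Subsets using (∣_∣; preimage)
  open Counting using (∑-preimage)
  open Geometry
  open ConvexCombination
  open Staircase a* a*≤m
  module ℚ-Group = GroupProperties ℚP.+-0-group

  combination : Fin m → ConvexCombination n
  combination b = proj₁ (convex-representation (proj₁ (faces b)))

  y≈combination : ∀ b → y b ≈V point (combination b)
  y≈combination b = proj₂ (convex-representation (proj₁ (faces b)))

  coef : ∀ b → Fin (size (combination b)) → ℚ
  coef b = coeff (combination b)

  vert : ∀ b → Fin (size (combination b)) → Subset n
  vert b = vertex (combination b)

  Supported : Fin m → (Subset n → Set) → Set
  Supported b P = ∀ k → 0ℚ < coef b k → P (vert b k)

  mass : Fin m → (Subset n → ℚ) → ℚ
  mass b g = ∑[ k < size (combination b) ] (coef b k * g (vert b k))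

  mass-cong : ∀ b (g h : Subset n → ℚ) → Supported b (λ S → g S ≡ h S) → mass b g ≡ mass b h
  mass-cong b g h g≡h = sum-cong-≗ pointwise
    where
    pointwise : ∀ k → coef b k * g (vert b k) ≡ coef b k * h (vert b k)
    pointwise k with ℚP.<-cmp 0ℚ (coef b k)
    ... | tri< 0<w _ _ = cong (coef b k *_) (g≡h k 0<w)
    ... | tri≈ _ 0≡w _ rewrite sym 0≡w = trans (ℚP.*-zeroˡ (g (vert b k))) (sym (ℚP.*-zeroˡ (h (vert b k))))
    ... | tri> _ _ w<0 = ⊥-elim (ℚP.<-irrefl refl (ℚP.<-≤-trans w<0 (coeff-nonneg (combination b) k)))

  mass-+ : ∀ b g h → mass b (λ S → g S + h S) ≡ mass b g + mass b h
  mass-+ b g h = trans (sum-cong-≗ (λ k → ℚP.*-distribˡ-+ (coef b k) (g (vert b k)) (h (vert b k))))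
                       (∑-distrib-+ (λ k → coef b k * g (vert b k)) (λ k → coef b k * h (vert b k)))

  mass-const : ∀ b q → mass b (λ _ → q) ≡ q
  mass-const b q = trans (sym (*-distribʳ-sum q (coef b))) (trans (cong (_* q) (coeff-sum (combination b))) (ℚP.*-identityˡ q))

  mass-nonneg : ∀ b β → 0ℚ ≤ mass b (ind ∘ β)
  mass-nonneg b β = ℚP.≤-trans (ℚP.≤-reflexive (sym (mass-const b 0ℚ))) (∑-mono-≤ pointwise)
    where
    pointwise : ∀ k → coef b k * 0ℚ ≤ coef b k * ind (β (vert b k))
    pointwise k = ℚP.*-monoˡ-≤-nonNeg (coef b k) {{ℚ.nonNegative (coeff-nonneg (combination b) k)}} (ind-nonneg (β (vert b k)))

  total : (Subset n → Bool) → ℚ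
  total β = ∑[ b < m ] mass b (ind ∘ β)

  total-all : total (λ _ → true) ≡ ι m
  total-all = trans (sum-cong-≗ (λ b → mass-const b 1ℚ)) (∑-1 m)

  total-vertex : ∀ i → total (λ S → lookup S i) ≡ ι (a* i)
  total-vertex i = sym (trans (proj₁ decomposed i) (trans (sumV-vertex y i)
    (sum-cong-≗ (λ b → trans (proj₁ (y≈combination b) i) (point-vertex (combination b) i)))))

  total-edge< : ∀ i j → i Fin.< j → total (λ S → lookup S i ∧ lookup S j) ≡ ι (a* i ⊓ a* j)
  total-edge< i j i<j = sym (trans (proj₂ decomposed i j i<j) (trans (sumV-edge y i j)
    (sum-cong-≗ (λ b → trans (proj₂ (y≈combination b) i j i<j) (point-edge (combination b) i j)))))

  total-edge : ∀ i j → i ≢ j → total (λ S → lookup S i ∧ lookup S j) ≡ ι (a* i ⊓ a* j)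
  total-edge i j i≢j with FinP.<-cmp i j
  ... | tri< i<j _ _ = total-edge< i j i<j
  ... | tri≈ _ i≡j _ = ⊥-elim (i≢j i≡j)
  ... | tri> _ _ j<i = trans (sum-cong-≗ swap) (trans (total-edge< j i j<i) (cong ι (ℕP.⊓-comm (a* j) (a* i))))
    where
    swap : ∀ b → mass b (λ S → ind (lookup S i ∧ lookup S j)) ≡ mass b (λ S → ind (lookup S j ∧ lookup S i))
    swap b = mass-cong b (λ S → ind (lookup S i ∧ lookup S j)) (λ S → ind (lookup S j ∧ lookup S i))
                         (λ k _ → cong ind (∧-comm (lookup (vert b k) i) (lookup (vert b k) j)))

  total-split : ∀ (β γ : Subset n → Bool) → total β ≡ total (λ S → β S ∧ γ S) + total (λ S → β S ∧ not (γ S))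
  total-split β γ = trans (sum-cong-≗ split) (∑-distrib-+ (λ b → mass b (ind ∘ β∧γ)) (λ b → mass b (ind ∘ β∧¬γ)))
    where
    β∧γ β∧¬γ : Subset n → Bool
    β∧γ  S = β S ∧ γ S
    β∧¬γ S = β S ∧ not (γ S)
    split : ∀ b → mass b (ind ∘ β) ≡ mass b (ind ∘ β∧γ) + mass b (ind ∘ β∧¬γ)
    split b = trans (mass-cong b (ind ∘ β) (λ S → ind (β∧γ S) + ind (β∧¬γ S)) (λ k _ → ind-split (β (vert b k)) (γ (vert b k))))
                    (mass-+ b (ind ∘ β∧γ) (ind ∘ β∧¬γ))

  support-avoids : ∀ (β : Subset n → Bool) → total β ≡ 0ℚ → ∀ b → Supported b (λ S → ¬ T (β S))
  support-avoids β total≡0 b k 0<w = ind-vanishes (β (vert b k))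
    (sym (∑-weighted-tight (coef b) (λ _ → 0ℚ) (ind ∘ β ∘ vert b) (coeff-nonneg (combination b))
                           (λ k → ind-nonneg (β (vert b k))) (trans no-mass (sym mass≡0)) k 0<w))
    where
    no-mass : ∑[ k < size (combination b) ] (coef b k * 0ℚ) ≡ 0ℚ
    no-mass = ∑-zero (λ k → ℚP.*-zeroʳ (coef b k))
    mass≡0 : mass b (ind ∘ β) ≡ 0ℚ
    mass≡0 = sym (∑-≤-≡⇒≡ (λ b → mass-nonneg b β) (trans (sum-replicate-zero m) (sym total≡0)) b)

  support-closed : ∀ (β γ : Subset n → Bool) → total β ≡ total (λ S → β S ∧ γ S) →
                   ∀ b → Supported b (λ S → T (β S) → T (γ S))
  support-closed β γ balanced b k 0<w =
    ¬T-∧-not⇒implies (β (vert b k)) (γ (vert b k)) (support-avoids (λ S → β S ∧ not (γ S)) leak≡0 b k 0<w)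
    where
    leak≡0 : total (λ S → β S ∧ not (γ S)) ≡ 0ℚ
    leak≡0 = ℚ-Group.∙-cancelˡ (total (λ S → β S ∧ γ S)) (total (λ S → β S ∧ not (γ S))) 0ℚ
               (trans (sym (total-split β γ)) (trans balanced (sym (ℚP.+-identityʳ (total (λ S → β S ∧ γ S))))))

  support-is-level : ∀ b → Supported b IsLevel
  support-is-level b k 0<w = is-level 1≤m avoids-zero contains-top upward
    where
    S = vert b k
    avoids-zero : ∀ i → a* i ≡ 0 → ¬ T (lookup S i)
    avoids-zero i a*i≡0 = support-avoids (λ S → lookup S i) (trans (total-vertex i) (cong ι a*i≡0)) b k 0<w
    contains-top : ∀ i → a* i ≡ m → T (lookup S i)
    contains-top i a*i≡m = support-closed (λ _ → true) (λ S → lookup S i)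
      (trans total-all (trans (cong ι (sym a*i≡m)) (sym (total-vertex i)))) b k 0<w tt
    upward : ∀ i j → a* i ℕ.≤ a* j → T (lookup S i) → T (lookup S j)
    upward i j a*i≤a*j with i Fin.≟ j
    ... | yes refl = λ i∈S → i∈S
    ... | no i≢j   = support-closed (λ S → lookup S i) (λ S → lookup S j)
      (trans (total-vertex i) (trans (cong ι (sym (ℕP.m≤n⇒m⊓n≡m a*i≤a*j))) (sym (total-edge i j i≢j)))) b k 0<w

  massUpTo : Fin m → ℕ → ℚ
  massUpTo b s = mass b (λ S → ind (threshold S ≤ᵇ s))

  massAt : Fin m → ℕ → ℚ
  massAt b s = mass b (λ S → ind (threshold S ≡ᵇ suc s))

  massAt-nonneg : ∀ b s → 0ℚ ≤ massAt b s
  massAt-nonneg b s = mass-nonneg b (λ S → threshold S ≡ᵇ suc s)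

  massUpTo-step : ∀ b s → massUpTo b (suc s) ≡ massAt b s + massUpTo b s
  massUpTo-step b s =
    trans (mass-cong b (λ S → ind (threshold S ≤ᵇ suc s)) (λ S → ind (threshold S ≡ᵇ suc s) + ind (threshold S ≤ᵇ s))
                       (λ k _ → ind-step (threshold (vert b k)) s))
          (mass-+ b (λ S → ind (threshold S ≡ᵇ suc s)) (λ S → ind (threshold S ≤ᵇ s)))

  massUpTo-zero : ∀ b → massUpTo b 0 ≡ 0ℚ
  massUpTo-zero b = trans (mass-cong b (λ S → ind (threshold S ≤ᵇ 0)) (λ _ → 0ℚ) (λ k 0<w → ind-¬T _ (positive k 0<w))) (mass-const b 0ℚ)
    where
    positive : ∀ k → 0ℚ < coef b k → ¬ T (threshold (vert b k) ≤ᵇ 0)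
    positive k 0<w = ℕP.<⇒≱ (IsLevel.threshold-positive (support-is-level b k 0<w)) ∘ ℕP.≤ᵇ⇒≤ _ 0

  massUpTo-top : ∀ b → massUpTo b m ≡ 1ℚ
  massUpTo-top b = trans (mass-cong b (λ S → ind (threshold S ≤ᵇ m)) (λ _ → 1ℚ) (λ k _ → ind-T _ (ℕP.≤⇒≤ᵇ (least-≤-top a* m (vert b k)))))
                         (mass-const b 1ℚ)

  massUpTo-a* : ∀ b i → massUpTo b (a* i) ≡ mass b (λ S → ind (lookup S i))
  massUpTo-a* b i = mass-cong b (λ S → ind (threshold S ≤ᵇ a* i)) (λ S → ind (lookup S i))
                                (λ k 0<w → cong ind (sym (IsLevel.membership (support-is-level b k 0<w) i)))

  massAt-off-breakpoints : ∀ b s → ¬ IsBreakpoint (suc s) → massAt b s ≡ 0ℚ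
  massAt-off-breakpoints b s ¬breakpoint =
    trans (mass-cong b (λ S → ind (threshold S ≡ᵇ suc s)) (λ _ → 0ℚ) (λ k _ → ind-¬T _ (missed (vert b k)))) (mass-const b 0ℚ)
    where
    missed : ∀ S → ¬ T (threshold S ≡ᵇ suc s)
    missed S hit = ¬breakpoint (subst IsBreakpoint (ℕP.≡ᵇ⇒≡ _ _ hit) (threshold-breakpoint S))

  ∑massUpTo : ∀ s → ∑[ b < m ] massUpTo b s ≡ ι (breakpoint-below s)
  ∑massUpTo zero = trans (sum-cong-≗ massUpTo-zero) (sum-replicate-zero m)
  ∑massUpTo (suc s) with breakpoint? (suc s)
  ... | yes (inj₁ s+1≡m)         = subst (λ v → ∑[ b < m ] massUpTo b v ≡ ι v) (sym s+1≡m)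
                                         (trans (sum-cong-≗ massUpTo-top) (∑-1 m))
  ... | yes (inj₂ (j , a*j≡s+1)) = subst (λ v → ∑[ b < m ] massUpTo b v ≡ ι v) a*j≡s+1
                                         (trans (sum-cong-≗ (λ b → massUpTo-a* b j)) (total-vertex j))
  ... | no ¬breakpoint           = trans (sum-cong-≗ flat) (∑massUpTo s)
    where
    flat : ∀ b → massUpTo b (suc s) ≡ massUpTo b s
    flat b = trans (massUpTo-step b s) (trans (cong (_+ massUpTo b s) (massAt-off-breakpoints b s ¬breakpoint))
                                              (ℚP.+-identityˡ (massUpTo b s)))

  capacity : Fin m → ℕ
  capacity t = gap (toℕ t)

  column-sum : ∀ t → ∑[ b < m ] massAt b (toℕ t) ≡ ι (capacity t)
  column-sum t = ℚ-Group.∙-cancelʳ (ι (breakpoint-below s)) (∑[ b < m ] massAt b s) (ι (capacity t)) (begin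
    ∑[ b < m ] massAt b s + ι (breakpoint-below s)     ≡⟨ cong (∑[ b < m ] massAt b s +_) (∑massUpTo s) ⟨
    ∑[ b < m ] massAt b s + ∑[ b < m ] massUpTo b s   ≡⟨ ∑-distrib-+ (λ b → massAt b s) (λ b → massUpTo b s) ⟨
    ∑[ b < m ] (massAt b s + massUpTo b s)            ≡⟨ sum-cong-≗ (λ b → massUpTo-step b s) ⟨
    ∑[ b < m ] massUpTo b (suc s)                     ≡⟨ ∑massUpTo (suc s) ⟩
    ι (breakpoint-below (suc s))                      ≡⟨ ι-gap s ⟩
    ι (capacity t) + ι (breakpoint-below s)           ∎)
    where
    open ≡-Reasoning
    s = toℕ t

  row-sum : ∀ b → ∑[ t < m ] massAt b (toℕ t) ≡ 1ℚ
  row-sum b = begin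
    ∑[ t < m ] massAt b (toℕ t)                   ≡⟨ sum-cong-≗ {m} (λ t → trans (cong (_* massAt b (toℕ t)) (below-m t))
                                                                                  (ℚP.*-identityˡ (massAt b (toℕ t)))) ⟨
    steps                                         ≡⟨ ℚP.+-identityʳ steps ⟨
    steps + 0ℚ                                    ≡⟨ cong (steps +_) (massUpTo-zero b) ⟨
    steps + massUpTo b 0                          ≡⟨ telescope (massUpTo b) (massAt b) (massUpTo-step b) m ℕP.≤-refl ⟩
    massUpTo b m                                  ≡⟨ massUpTo-top b ⟩
    1ℚ                                            ∎
    where
    open ≡-Reasoning
    steps = ∑[ t < m ] (ind (suc (toℕ t) ≤ᵇ m) * massAt b (toℕ t))
    below-m : ∀ (t : Fin m) → ind (suc (toℕ t) ≤ᵇ m) ≡ 1ℚ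
    below-m t = ind-T (suc (toℕ t) ≤ᵇ m) (ℕP.≤⇒≤ᵇ (FinP.toℕ<n t))

  assignment : ∃ λ (assign : Fin m → Fin m) →
                 (∀ b → 0ℚ < massAt b (toℕ (assign b))) × (∀ t → ∣ preimage assign t ∣ ≡ capacity t)
  assignment = Rounding.integral-assignment (λ b t → massAt b (toℕ t)) (λ b t → massAt-nonneg b (toℕ t)) row-sum capacity column-sum

  assign : Fin m → Fin m
  assign = proj₁ assignment

  chosen : ∀ b → ∃ λ k → 0ℚ < coef b k × threshold (vert b k) ≡ suc (toℕ (assign b))
  chosen b = k , proj₁ positive , ℕP.≡ᵇ⇒≡ (threshold (vert b k)) (suc (toℕ (assign b))) (proj₂ positive)
    where
    hits : Fin (size (combination b)) → Bool
    hits k = threshold (vert b k) ≡ᵇ suc (toℕ (assign b))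
    term = ∑-positive⇒∃ (λ k → coef b k * ind (hits k)) (proj₁ (proj₂ assignment) b)
    k = proj₁ term
    positive = *-ind-positive (coef b k) (hits k) (proj₂ term)

  χ : Fin m → Subset n
  χ b = vert b (proj₁ (chosen b))

  χ-face : ∀ b → IsVertexOfFace (c b) (χ b)
  χ-face b = face-support {c = c b} {y = y b} (combination b) (faces b) (y≈combination b) (proj₁ (chosen b)) (proj₁ (proj₂ (chosen b)))

  χ-level : ∀ b i → lookup (χ b) i ≡ (suc (toℕ (assign b)) ≤ᵇ a* i)
  χ-level b i = trans (IsLevel.membership (support-is-level b (proj₁ (chosen b)) (proj₁ (proj₂ (chosen b)))) i)
                      (cong (_≤ᵇ a* i) (proj₂ (proj₂ (chosen b))))

  assigned-below : ∀ i → ∑[ b < m ] ind (suc (toℕ (assign b)) ≤ᵇ a* i) ≡ ι (a* i)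
  assigned-below i = begin
    ∑[ b < m ] ind (suc (toℕ (assign b)) ≤ᵇ a* i)         ≡⟨ ∑-preimage assign below ⟩
    ∑[ t < m ] (ι ∣ preimage assign t ∣ * below t)        ≡⟨ sum-cong-≗ (λ t → trans (cong (λ x → ι x * below t) (proj₂ (proj₂ assignment) t))
                                                                                     (ℚP.*-comm (ι (capacity t)) (below t))) ⟩
    steps                                                 ≡⟨ ℚP.+-identityʳ steps ⟨
    steps + ι (breakpoint-below 0)                        ≡⟨ telescope (ι ∘ breakpoint-below) (ι ∘ gap) ι-gap (a* i) (a*≤m i) ⟩
    ι (breakpoint-below (a* i))                           ≡⟨ cong ι (breakpoint-below-a* i) ⟩
    ι (a* i)                                              ∎
    where
    open ≡-Reasoning
    below : Fin m → ℚ
    below t = ind (suc (toℕ t) ≤ᵇ a* i)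
    steps = ∑[ t < m ] (below t * ι (capacity t))

  vertex-choice : ∃ λ (χ : Fin m → Subset n) →
                    (∀ b → IsVertexOfFace (c b) (χ b)) × toℚV target ≈V sumV (λ b → aS (χ b))
  vertex-choice = χ , χ-face , staircase-sum χ (λ b → suc (toℕ (assign b))) χ-level assigned-below

open import Data.Nat using (ℕ; _≤_)
open import Data.Integer using (+_)
open import Data.Rational using (_/_)
open import Data.Fin using (Fin)
open import Data.Fin.Subset using (Subset)
open import Data.Product using (_×_; ∃; proj₁)
open import Relation.Binary.PropositionalEquality using (_≡_)

proposition4p4 :
    (n m : ℕ) → 1 ≤ n → 1 ≤ m →
    (a* : Fin n → ℕ) → (∀ i → a* i ≤ m) →
    ∃ λ (a : ZVect n) →
      InDilate (+ m / 1) (toℚV a)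
      × (∀ i → proj₁ a i ≡ + a* i)
      × ((c : Fin m → Vect n) → (y : Fin m → Vect n) →
          (∀ b → InFace (c b) (y b)) → toℚV a ≈V sumV y →
          ∃ λ (χ : Fin m → Subset n) →
            (∀ b → IsVertexOfFace (c b) (χ b)) × toℚV a ≈V sumV (λ b → aS (χ b)))
proposition4p4 n m _ 1≤m a* a*≤m =
  target , target-in-dilate , (λ i → refl) , Decomposition.vertex-choice 1≤m a* a*≤m
  where open Staircase a* a*≤m
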